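{- Let $\equiv$ be a lattice congruence of the weak order on $W$. For any standard parabolic coset $xW_I$: (i) $\Pi^\uparrow(xW_I)=xW_I$ if and only if $\pi^\uparrow(x)=x$; (ii) $\Pi^\downarrow(xW_I)=xW_I$ if and only if $\pi^\downarrow(xw_{\circ,I})=xw_{\circ,I}$.
   Context: $(W,S)$ is a finite Coxeter system with length $\ell$; weak order $u\le v$ iff $\ell(u)+\ell(u^{ -1}v)=\ell(v)$. For $I\subseteq S$: $W_I=\langle I\rangle$, $w_{\circ,I}$ its longest element, $W^I=\{w:\ell(ws)>\ell(w)\ \forall s\in I\}$; $D_R(w)=\{s:\ell(ws)<\ell(w)\}$. Standard parabolic cosets are $xW_I$ with $x\in W^I$. For the lattice congruence $\equiv$, $\pi^\uparrow(w)$ and $\pi^\downarrow(w)$ are the maximal and minimal elements of the class of $w$. For each coset $xW_I$ there is a unique $\Sigma^\uparrow(x,I)\subseteq S\setminus D_R(\pi^\uparrow(x))$ with $xw_{\circ,I}\le\pi^\uparrow(x)w_{\circ,\Sigma^\uparrow(x,I)}$ and $xw_{\circ,I}\equiv\pi^\uparrow(x)w_{\circ,\Sigma^\uparrow(x,I)}$, and a unique $\Sigma_\downarrow(x,I)\subseteq D_R(\pi^\downarrow(xw_{\circ,I}))$ with $\pi^\downarrow(xw_{\circ,I})w_{\circ,\Sigma_\downarrow(x,I)}\le x$ and $\pi^\downarrow(xw_{\circ,I})w_{\circ,\Sigma_\downarrow(x,I)}\equiv x$. Define $\Pi^\uparrow(xW_I)=\pi^\uparrow(x)W_{\Sigma^\uparrow(x,I)}$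 and $\Pi^\downarrow(xW_I)$ as the coset $\pi^\downarrow(xw_{\circ,I})W_{\Sigma_\downarrow(x,I)}$ (minimal element $\pi^\downarrow(xw_{\circ,I})w_{\circ,\Sigma_\downarrow(x,I)}$). -}

module Defs where

open import Level using (0ℓ)
open import Algebra.Bundles using (Group)
open import Data.Nat using (ℕ; zero; suc; _+_; _≤_; _<_)
open import Data.Fin using (Fin)
open import Data.Fin.Subset using (Subset; _∈_)
open import Data.List using (List; []; _∷_; foldr; length)
open import Data.List.Relation.Unary.All using (All)
import Data.List.Membership.Propositional as LMem
open import Data.Product using (Σ; _×_; _,_)
open import Relation.Binary.PropositionalEquality using (_≡_; _≢_)
open import Relation.Nullary using (¬_)

pow : {A : Set} → (A → A → A) → A → A → ℕ → A
pow _·_ e a zero = e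
pow _·_ e a (suc k) = a · pow _·_ e a k

evalWord : {A : Set} {n : ℕ} → (A → A → A) → A → (Fin n → A) → List (Fin n) → A
evalWord _·_ e s ws = foldr (λ i w → s i · w) e ws

IsGroupHom : {A : Set} → (A → A → A) → (G : Group 0ℓ 0ℓ) → (A → Group.Carrier G) → Set
IsGroupHom _·_ G φ = ∀ a b → φ (a · b) ≈ (φ a ∙ φ b)
  where open Group G

-- A finite Coxeter system (W,S), S = {s i | i : Fin n}, given by its Coxeter
-- presentation ⟨ S | (s i s j)^(m i j) = e ⟩ (universal property of the presented
-- group), together with the length function ℓ (uniquely specified as the minimal
-- length of a word in S representing the element).
record CoxeterSystem : Set₁ where
  field
    W        : Set
    _·_      : W → W → W
    e        : W
    _⁻¹      : W → W
    assoc    : ∀ a b c → (a · b) · c ≡ a · (b · c)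
    identityˡ : ∀ a → e · a ≡ a
    identityʳ : ∀ a → a · e ≡ a
    inverseˡ : ∀ a → (a ⁻¹) · a ≡ e
    inverseʳ : ∀ a → a · (a ⁻¹) ≡ e
    n        : ℕ
    m        : Fin n → Fin n → ℕ
    m-diag   : ∀ i → m i i ≡ 1
    m-sym    : ∀ i j → m i j ≡ m j i
    m-off    : ∀ i j → i ≢ j → 2 ≤ m i j
    s        : Fin n → W
    relations : ∀ i j → pow _·_ e (s i · s j) (m i j) ≡ e
    generates : ∀ w → Σ (List (Fin n)) λ ws → evalWord _·_ e s ws ≡ w
    universal : (G : Group 0ℓ 0ℓ) (f : Fin n → Group.Carrier G) →
                (∀ i j → Group._≈_ G (pow (Group._∙_ G) (Group.ε G) (Group._∙_ G (f i) (f j)) (m i j)) (Group.ε G)) →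
                Σ (W → Group.Carrier G) λ φ → IsGroupHom _·_ G φ × (∀ i → Group._≈_ G (φ (s i)) (f i))
    uniqueness : (G : Group 0ℓ 0ℓ) (φ ψ : W → Group.Carrier G) →
                 IsGroupHom _·_ G φ → IsGroupHom _·_ G ψ →
                 (∀ i → Group._≈_ G (φ (s i)) (ψ (s i))) → ∀ w → Group._≈_ G (φ w) (ψ w)
    elements : List W
    complete : ∀ w → LMem._∈_ w elements
    ℓ          : W → ℕ
    ℓ-attained : ∀ w → Σ (List (Fin n)) λ ws → evalWord _·_ e s ws ≡ w × length ws ≡ ℓ w
    ℓ-minimal  : ∀ w (ws : List (Fin n)) → evalWord _·_ e s ws ≡ w → ℓ w ≤ length ws

module Coxeter (C : CoxeterSystem) where
  open CoxeterSystem C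

  _≤w_ : W → W → Set
  u ≤w v = ℓ u + ℓ ((u ⁻¹) · v) ≡ ℓ v

  InParabolic : Subset n → W → Set
  InParabolic I w = Σ (List (Fin n)) λ ws → All (λ i → i ∈ I) ws × evalWord _·_ e s ws ≡ w

  InCoset : W → Subset n → W → Set
  InCoset x I w = InParabolic I ((x ⁻¹) · w)

  SameCoset : W → Subset n → W → Subset n → Set
  SameCoset x I y J = ∀ w → (InCoset x I w → InCoset y J w) × (InCoset y J w → InCoset x I w)

  MinimalRep : Subset n → W → Set
  MinimalRep I x = ∀ i → i ∈ I → ℓ x < ℓ (x · s i)

  RightDescent : W → Fin n → Set
  RightDescent w i = ℓ (w · s i) < ℓ w

  IsLongest : Subset n → W → Set
  IsLongest I w = InParabolic I w × (∀ u → InParabolic I u → ℓ u ≤ ℓ w)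

  IsJoin : W → W → W → Set
  IsJoin a b j = a ≤w j × b ≤w j × (∀ u → a ≤w u → b ≤w u → j ≤w u)

  IsMeet : W → W → W → Set
  IsMeet a b j = j ≤w a × j ≤w b × (∀ u → u ≤w a → u ≤w b → u ≤w j)

  record LatticeCongruence (R : W → W → Set) : Set where
    field
      refl′  : ∀ a → R a a
      sym′   : ∀ a b → R a b → R b a
      trans′ : ∀ a b c → R a b → R b c → R a c
      join-compat : ∀ a b c j k → R a b → IsJoin a c j → IsJoin b c k → R j k
      meet-compat : ∀ a b c j k → R a b → IsMeet a c j → IsMeet b c k → R j k

  IsTopOf : (W → W → Set) → W → W → Set
  IsTopOf R w t = R w t × (∀ u → R w u → u ≤w t)

  IsBottomOf : (W → W → Set) → W → W → Set
  IsBottomOf R w b = R w b × (∀ u → R w u → b ≤w u)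

module Submission where

-- The engine is the reflection cocycle of (W,S).  By the universal property
-- of the Coxeter presentation, s_i ↦ ((t , b) ↦ (s_i t s_i , b xor [t = s_i]))
-- extends to an action of W on W × Bool; its Boolean part N w t satisfies
-- N (w v) t = N v t xor N w (v t v⁻¹).  A deletion argument shows that for a
-- reflection t, N w t holds exactly when ℓ(wt) < ℓ(w), and that the right
-- weak order is inclusion of left inversion sets: u ≤ w iff N(u⁻¹) ⊆ N(w⁻¹).
-- From this we derive the parabolic facts used below: a minimal coset
-- representative x ∈ W^J inverts no reflection of W_J and lies below every
-- xg (g ∈ W_J), while w_{∘,J} inverts every reflection of W_J.
--
-- The "only if" directions are length arguments.  For the "if" directions
-- we show W_I = W_Σ: one inclusion compares inversion sets, the other
-- computes a meet (part (i)) resp. a join (part (ii)) through inversion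
-- sets; the lattice congruence then relates two comparable elements of
-- different length, contradicting maximality of π↑ (minimality of π↓).

open import Defs
open import Level using (0ℓ)
open import Algebra.Bundles using (Group)
open import Data.Nat using (ℕ; zero; suc; _+_; _≤_; _<_; z≤n; s≤s; s≤s⁻¹; _≤?_) renaming (_≟_ to _≟ℕ_)
open import Data.Nat.Properties
open import Data.Bool using (Bool; true; false; _xor_) renaming (_≟_ to _≟𝔹_)
open import Data.Bool.Properties using (xor-assoc; xor-same; xor-identityʳ; xor-inverseʳ)
open import Data.Fin using (Fin)
open import Data.Fin.Properties using (any?)
open import Data.Fin.Subset using (Subset; _∈_)
open import Data.Fin.Subset.Properties using (_∈?_)
open import Data.List using (List; []; _∷_; _++_; length; reverse; [_])
open import Data.List.Properties using (length-++; length-reverse; unfold-reverse)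
open import Data.List.Relation.Unary.All using (All; []; _∷_)
open import Data.List.Relation.Unary.All.Properties using (++⁺; ++⁻ˡ; ++⁻ʳ)
open import Data.Product using (Σ; _×_; _,_; proj₁; proj₂)
open import Data.Sum using (_⊎_; inj₁; inj₂)
open import Data.Empty using (⊥; ⊥-elim)
open import Function using (_∘_; id)
open import Relation.Binary.PropositionalEquality hiding ([_])
open import Relation.Nullary using (¬_; Dec; yes; no; does; _×-dec_)

module GroupBasics (C : CoxeterSystem) where
  open CoxeterSystem C
  open Coxeter C
  open ≡-Reasoning

  inv-unique : ∀ a b → a · b ≡ e → b ≡ a ⁻¹
  inv-unique a b h = begin
    b                ≡⟨ sym (identityˡ b) ⟩
    e · b            ≡⟨ cong (_· b) (sym (inverseˡ a)) ⟩
    ((a ⁻¹) · a) · b ≡⟨ assoc _ _ _ ⟩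
    (a ⁻¹) · (a · b) ≡⟨ cong ((a ⁻¹) ·_) h ⟩
    (a ⁻¹) · e       ≡⟨ identityʳ _ ⟩
    a ⁻¹             ∎

  inv-inv : ∀ a → (a ⁻¹) ⁻¹ ≡ a
  inv-inv a = sym (inv-unique (a ⁻¹) a (inverseˡ a))

  inv-e : e ⁻¹ ≡ e
  inv-e = sym (inv-unique e e (identityˡ e))

  inv-cancelˡ : ∀ a b → (a ⁻¹) · (a · b) ≡ b
  inv-cancelˡ a b = trans (sym (assoc _ _ _)) (trans (cong (_· b) (inverseˡ a)) (identityˡ b))

  inv-cancelˡ′ : ∀ a b → a · ((a ⁻¹) · b) ≡ b
  inv-cancelˡ′ a b = trans (sym (assoc _ _ _)) (trans (cong (_· b) (inverseʳ a)) (identityˡ b))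

  inv-cancelʳ : ∀ a b → (a · b) · (b ⁻¹) ≡ a
  inv-cancelʳ a b = trans (assoc _ _ _) (trans (cong (a ·_) (inverseʳ b)) (identityʳ a))

  inv-cancelʳ′ : ∀ a b → (a · (b ⁻¹)) · b ≡ a
  inv-cancelʳ′ a b = trans (assoc _ _ _) (trans (cong (a ·_) (inverseˡ b)) (identityʳ a))

  inv-mul : ∀ a b → (a · b) ⁻¹ ≡ (b ⁻¹) · (a ⁻¹)
  inv-mul a b = sym (inv-unique (a · b) ((b ⁻¹) · (a ⁻¹)) (begin
    (a · b) · ((b ⁻¹) · (a ⁻¹)) ≡⟨ assoc _ _ _ ⟩
    a · (b · ((b ⁻¹) · (a ⁻¹))) ≡⟨ cong (a ·_) (inv-cancelˡ′ b (a ⁻¹)) ⟩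
    a · (a ⁻¹)                  ≡⟨ inverseʳ a ⟩
    e                           ∎))

  cancelˡ : ∀ a b c → a · b ≡ a · c → b ≡ c
  cancelˡ a b c h = trans (sym (inv-cancelˡ a b)) (trans (cong ((a ⁻¹) ·_) h) (inv-cancelˡ a c))

  s-square : ∀ i → s i · s i ≡ e
  s-square i with relations i i
  ... | r rewrite m-diag i = trans (sym (identityʳ _)) r

  s-inv : ∀ i → s i ⁻¹ ≡ s i
  s-inv i = sym (inv-unique (s i) (s i) (s-square i))

  s-cancelʳ : ∀ w i → (w · s i) · s i ≡ w
  s-cancelʳ w i = trans (assoc _ _ _) (trans (cong (w ·_) (s-square i)) (identityʳ w))

  s-cancelˡ : ∀ w i → s i · (s i · w) ≡ w
  s-cancelˡ w i = trans (sym (assoc _ _ _)) (trans (cong (_· w) (s-square i)) (identityˡ w))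

  inv-ws : ∀ w i → (w · s i) ⁻¹ ≡ s i · (w ⁻¹)
  inv-ws w i = trans (inv-mul w (s i)) (cong (_· (w ⁻¹)) (s-inv i))

  inv-sw : ∀ w i → (s i · w) ⁻¹ ≡ (w ⁻¹) · s i
  inv-sw w i = trans (inv-mul (s i) w) (cong ((w ⁻¹) ·_) (s-inv i))

  eval : List (Fin n) → W
  eval ws = evalWord _·_ e s ws

  eval-++ : ∀ a b → eval (a ++ b) ≡ eval a · eval b
  eval-++ [] b = sym (identityˡ _)
  eval-++ (i ∷ a) b = trans (cong (s i ·_) (eval-++ a b)) (sym (assoc _ _ _))

  eval-snoc : ∀ p j → eval (p ++ [ j ]) ≡ eval p · s j
  eval-snoc p j = trans (eval-++ p [ j ]) (cong (eval p ·_) (identityʳ (s j)))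

  eval-reverse : ∀ a → eval (reverse a) ≡ eval a ⁻¹
  eval-reverse [] = sym inv-e
  eval-reverse (i ∷ a) = begin
    eval (reverse (i ∷ a))        ≡⟨ cong eval (unfold-reverse i a) ⟩
    eval (reverse a ++ [ i ])     ≡⟨ eval-snoc (reverse a) i ⟩
    eval (reverse a) · s i        ≡⟨ cong₂ _·_ (eval-reverse a) (sym (s-inv i)) ⟩
    (eval a ⁻¹) · (s i ⁻¹)        ≡⟨ sym (inv-mul _ _) ⟩
    (s i · eval a) ⁻¹             ∎

  All-reverse : ∀ {P : Fin n → Set} a → All P a → All P (reverse a)
  All-reverse [] [] = []
  All-reverse {P} (i ∷ a) (p ∷ ps) =
    subst (All P) (sym (unfold-reverse i a)) (++⁺ (All-reverse a ps) (p ∷ []))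

  last-letter : ∀ (i : Fin n) a → Σ (List (Fin n)) λ p → Σ (Fin n) λ j → i ∷ a ≡ p ++ [ j ]
  last-letter i [] = [] , i , refl
  last-letter i (k ∷ a) with last-letter k a
  ... | p , j , eq = i ∷ p , j , cong (i ∷_) eq

  ℓ-word : ∀ a → ℓ (eval a) ≤ length a
  ℓ-word a = ℓ-minimal (eval a) a refl

  ℓ-e : ℓ e ≡ 0
  ℓ-e = n≤0⇒n≡0 (ℓ-word [])

  ℓ≡0⇒e : ∀ w → ℓ w ≡ 0 → w ≡ e
  ℓ≡0⇒e w h with ℓ-attained w
  ... | [] , ev , _ = sym ev
  ... | (i ∷ a) , ev , len with trans len h
  ... | ()

  ℓ-mul : ∀ u v → ℓ (u · v) ≤ ℓ u + ℓ v
  ℓ-mul u v with ℓ-attained u | ℓ-attained v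
  ... | a , refl , la | b , refl , lb =
    ≤-trans (≤-reflexive (cong ℓ (sym (eval-++ a b))))
      (≤-trans (ℓ-word (a ++ b)) (≤-reflexive (trans (length-++ a) (cong₂ _+_ la lb))))

  ℓ-inv≤ : ∀ w → ℓ (w ⁻¹) ≤ ℓ w
  ℓ-inv≤ w with ℓ-attained w
  ... | a , refl , la = subst₂ _≤_ (cong ℓ (eval-reverse a)) (trans (length-reverse a) la) (ℓ-word (reverse a))

  ℓ-inv : ∀ w → ℓ (w ⁻¹) ≡ ℓ w
  ℓ-inv w = ≤-antisym (ℓ-inv≤ w) (subst (λ z → ℓ z ≤ ℓ (w ⁻¹)) (inv-inv w) (ℓ-inv≤ (w ⁻¹)))

  ℓ-s≤1 : ∀ i → ℓ (s i) ≤ 1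
  ℓ-s≤1 i = subst (λ z → ℓ z ≤ 1) (identityʳ (s i)) (ℓ-word [ i ])

  ℓ-ws≤ : ∀ w i → ℓ (w · s i) ≤ suc (ℓ w)
  ℓ-ws≤ w i = ≤-trans (ℓ-mul w (s i)) (≤-trans (+-monoʳ-≤ (ℓ w) (ℓ-s≤1 i)) (≤-reflexive (+-comm (ℓ w) 1)))

  ℓ-w≤ : ∀ w i → ℓ w ≤ suc (ℓ (w · s i))
  ℓ-w≤ w i = subst (λ z → ℓ z ≤ suc (ℓ (w · s i))) (s-cancelʳ w i) (ℓ-ws≤ (w · s i) i)

  ℓ-sw≤ : ∀ w i → ℓ (s i · w) ≤ suc (ℓ w)
  ℓ-sw≤ w i = ≤-trans (ℓ-mul (s i) w) (+-monoˡ-≤ (ℓ w) (ℓ-s≤1 i))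

  ℓ-w≤′ : ∀ w i → ℓ w ≤ suc (ℓ (s i · w))
  ℓ-w≤′ w i = subst (λ z → ℓ z ≤ suc (ℓ (s i · w))) (s-cancelˡ w i) (ℓ-sw≤ (s i · w) i)

  ℓ-sw≡ℓ-inv-s : ∀ w i → ℓ (s i · w) ≡ ℓ ((w ⁻¹) · s i)
  ℓ-sw≡ℓ-inv-s w i = trans (sym (ℓ-inv _)) (cong ℓ (inv-sw w i))

  -- Equality in W is decidable: u = v iff ℓ(u⁻¹v) = 0.
  _≟W_ : (u v : W) → Dec (u ≡ v)
  u ≟W v with ℓ ((u ⁻¹) · v) ≟ℕ 0
  ... | yes h = yes (trans (sym (identityʳ u)) (trans (cong (u ·_) (sym (ℓ≡0⇒e _ h))) (inv-cancelˡ′ u v)))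
  ... | no h = no λ { refl → h (trans (cong ℓ (inverseˡ u)) ℓ-e) }

  δ : W → W → Bool
  δ u v = does (u ≟W v)

  δ-cong : ∀ {u v u′ v′} → (u ≡ v → u′ ≡ v′) → (u′ ≡ v′ → u ≡ v) → δ u v ≡ δ u′ v′
  δ-cong {u} {v} {u′} {v′} f g with u ≟W v | u′ ≟W v′
  ... | yes p | yes q = refl
  ... | yes p | no q = ⊥-elim (q (f p))
  ... | no p | yes q = ⊥-elim (p (g q))
  ... | no p | no q = refl

  δ-true : ∀ {u v} → δ u v ≡ true → u ≡ v
  δ-true {u} {v} h with u ≟W v
  ... | yes p = p
  δ-true () | no _

  δ-refl : ∀ u → δ u u ≡ true
  δ-refl u with u ≟W u
  ... | yes _ = refl
  ... | no p = ⊥-elim (p refl)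

  conj : W → W → W
  conj c t = c · (t · (c ⁻¹))

  conj-comp : ∀ a b t → conj a (conj b t) ≡ conj (a · b) t
  conj-comp a b t = begin
    a · ((b · (t · (b ⁻¹))) · (a ⁻¹)) ≡⟨ cong (a ·_) (assoc _ _ _) ⟩
    a · (b · ((t · (b ⁻¹)) · (a ⁻¹))) ≡⟨ sym (assoc _ _ _) ⟩
    (a · b) · ((t · (b ⁻¹)) · (a ⁻¹)) ≡⟨ cong ((a · b) ·_) (assoc _ _ _) ⟩
    (a · b) · (t · ((b ⁻¹) · (a ⁻¹))) ≡⟨ cong (λ z → (a · b) · (t · z)) (sym (inv-mul a b)) ⟩
    (a · b) · (t · ((a · b) ⁻¹))      ∎

  conj-e : ∀ t → conj e t ≡ t
  conj-e t = trans (identityˡ _) (trans (cong (t ·_) inv-e) (identityʳ t))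

  conj-cancel : ∀ c t → conj (c ⁻¹) (conj c t) ≡ t
  conj-cancel c t = trans (conj-comp _ _ _) (trans (cong (λ z → conj z t) (inverseˡ c)) (conj-e t))

  conj-cancel′ : ∀ c t → conj c (conj (c ⁻¹) t) ≡ t
  conj-cancel′ c t = trans (conj-comp _ _ _) (trans (cong (λ z → conj z t) (inverseʳ c)) (conj-e t))

  conj-s-cancel : ∀ i t → conj (s i) (conj (s i) t) ≡ t
  conj-s-cancel i t = trans (conj-comp _ _ _) (trans (cong (λ z → conj z t) (s-square i)) (conj-e t))

  conj-injective : ∀ c t u → conj c t ≡ conj c u → t ≡ u
  conj-injective c t u h = trans (sym (conj-cancel c t)) (trans (cong (conj (c ⁻¹)) h) (conj-cancel c u))

  conj-self : ∀ c → conj c c ≡ c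
  conj-self c = trans (sym (assoc _ _ _)) (inv-cancelʳ c c)

  conj-mul : ∀ v x y → conj v x · conj v y ≡ conj v (x · y)
  conj-mul v x y = begin
    (v · (x · (v ⁻¹))) · (v · (y · (v ⁻¹))) ≡⟨ assoc _ _ _ ⟩
    v · ((x · (v ⁻¹)) · (v · (y · (v ⁻¹)))) ≡⟨ cong (v ·_) (assoc _ _ _) ⟩
    v · (x · ((v ⁻¹) · (v · (y · (v ⁻¹))))) ≡⟨ cong (λ z → v · (x · z)) (inv-cancelˡ v _) ⟩
    v · (x · (y · (v ⁻¹)))                  ≡⟨ cong (v ·_) (sym (assoc _ _ _)) ⟩
    conj v (x · y)                          ∎

  conj-of-e : ∀ v → conj v e ≡ e
  conj-of-e v = trans (cong (v ·_) (identityˡ _)) (inverseʳ v)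

  conj-back : ∀ c t → conj c t · c ≡ c · t
  conj-back c t = trans (assoc _ _ _) (cong (c ·_) (inv-cancelʳ′ t c))

  δ-conj : ∀ c t u → δ (conj c t) (conj c u) ≡ δ t u
  δ-conj c t u = δ-cong (conj-injective c t u) (cong (conj c))

  parabolic-e : ∀ J → InParabolic J e
  parabolic-e J = [] , [] , refl

  parabolic-s : ∀ J i → i ∈ J → InParabolic J (s i)
  parabolic-s J i i∈J = [ i ] , i∈J ∷ [] , identityʳ (s i)

  parabolic-mul : ∀ J a b → InParabolic J a → InParabolic J b → InParabolic J (a · b)
  parabolic-mul J a b (p , ap , refl) (q , aq , refl) = p ++ q , ++⁺ ap aq , eval-++ p q

  parabolic-inv : ∀ J a → InParabolic J a → InParabolic J (a ⁻¹)
  parabolic-inv J a (p , ap , refl) = reverse p , All-reverse p ap , eval-reverse p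

  parabolic-conj : ∀ J g r → InParabolic J g → InParabolic J r → InParabolic J (conj g r)
  parabolic-conj J g r g∈ r∈ = parabolic-mul J g _ g∈ (parabolic-mul J r _ r∈ (parabolic-inv J g g∈))

  parabolic-mono : ∀ J K → (∀ i → i ∈ J → InParabolic K (s i)) → ∀ w → InParabolic J w → InParabolic K w
  parabolic-mono J K f _ ([] , [] , refl) = parabolic-e K
  parabolic-mono J K f _ ((i ∷ a) , (i∈ ∷ a∈) , refl) =
    parabolic-mul K (s i) (eval a) (f i i∈) (parabolic-mono J K f (eval a) (a , a∈ , refl))

-- W acts on W × Bool by
--   s_i · (t , b) = (s_i t s_i , b xor [t = s_i]);
-- the Coxeter relations hold in the group of permutations of W × Bool, so the
-- universal property yields the action, and N w t is its Boolean part.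
module ReflectionCocycle (C : CoxeterSystem) where
  open CoxeterSystem C
  open Coxeter C
  open GroupBasics C
  open ≡-Reasoning

  record Perm : Set where
    field
      fw bw : W × Bool → W × Bool
      fw-bw : ∀ x → fw (bw x) ≡ x
      bw-fw : ∀ x → bw (fw x) ≡ x
  open Perm public

  _≈P_ : Perm → Perm → Set
  p ≈P q = ∀ x → fw p x ≡ fw q x

  _∘P_ : Perm → Perm → Perm
  p ∘P q = record { fw = fw p ∘ fw q ; bw = bw q ∘ bw p
                  ; fw-bw = λ x → trans (cong (fw p) (fw-bw q (bw p x))) (fw-bw p x)
                  ; bw-fw = λ x → trans (cong (bw q) (bw-fw p (fw q x))) (bw-fw q x) }

  idP : Perm
  idP = record { fw = id ; bw = id ; fw-bw = λ _ → refl ; bw-fw = λ _ → refl }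

  PermGroup : Group 0ℓ 0ℓ
  PermGroup = record
    { Carrier = Perm ; _≈_ = _≈P_ ; _∙_ = _∘P_ ; ε = idP
    ; _⁻¹ = λ p → record { fw = bw p ; bw = fw p ; fw-bw = bw-fw p ; bw-fw = fw-bw p }
    ; isGroup = record
      { isMonoid = record
        { isSemigroup = record
          { isMagma = record
            { isEquivalence = record { refl = λ _ → refl ; sym = λ h x → sym (h x)
                                     ; trans = λ h k x → trans (h x) (k x) }
            ; ∙-cong = λ {p} h k x → trans (cong (fw p) (k x)) (h _) }
          ; assoc = λ _ _ _ _ → refl }
        ; identity = (λ _ _ → refl) , (λ _ _ → refl) }
      ; inverse = (λ p x → bw-fw p x) , (λ p x → fw-bw p x)
      ; ⁻¹-cong = λ {p} {q} h x → trans (cong (bw p) (sym (trans (h (bw q x)) (fw-bw q x)))) (bw-fw p (bw q x)) } }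

  xor-cancel : ∀ a b → (a xor b) xor b ≡ a
  xor-cancel a b = trans (xor-assoc a b b) (trans (cong (a xor_) (xor-same b)) (xor-identityʳ a))

  η : Fin n → W × Bool → W × Bool
  η i (t , b) = conj (s i) t , b xor δ t (s i)

  η-involutive : ∀ i x → η i (η i x) ≡ x
  η-involutive i (t , b) = cong₂ _,_ (conj-s-cancel i t)
    (trans (cong ((b xor δ t (s i)) xor_) δ-conj-s) (xor-cancel b _))
    where
      δ-conj-s : δ (conj (s i) t) (s i) ≡ δ t (s i)
      δ-conj-s = trans (cong (δ (conj (s i) t)) (sym (conj-self (s i)))) (δ-conj (s i) t (s i))

  ηP : Fin n → Perm
  ηP i = record { fw = η i ; bw = η i ; fw-bw = η-involutive i ; bw-fw = η-involutive i }

  permOf : List (Fin n) → Perm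
  permOf [] = idP
  permOf (i ∷ a) = ηP i ∘P permOf a

  parity : List (Fin n) → W → Bool
  parity [] t = false
  parity (i ∷ a) t = parity a t xor δ (conj (eval a) t) (s i)

  permOf-action : ∀ a t b → fw (permOf a) (t , b) ≡ (conj (eval a) t , b xor parity a t)
  permOf-action [] t b = cong₂ _,_ (sym (conj-e t)) (sym (xor-identityʳ b))
  permOf-action (i ∷ a) t b rewrite permOf-action a t b =
    cong₂ _,_ (conj-comp _ _ _) (xor-assoc b (parity a t) _)

  pw : W → ℕ → W
  pw a k = pow _·_ e a k

  pw-suc′ : ∀ a k → pw a (suc k) ≡ pw a k · a
  pw-suc′ a zero = trans (identityʳ a) (sym (identityˡ a))
  pw-suc′ a (suc k) = trans (cong (a ·_) (pw-suc′ a k)) (sym (assoc _ _ _))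

  pw-+ : ∀ a k l → pw a (k + l) ≡ pw a k · pw a l
  pw-+ a zero l = sym (identityˡ _)
  pw-+ a (suc k) l = trans (cong (a ·_) (pw-+ a k l)) (sym (assoc _ _ _))

  pw-inverse : ∀ a b → a · b ≡ e → ∀ k → pw a k · pw b k ≡ e
  pw-inverse a b h zero = identityˡ e
  pw-inverse a b h (suc k) = begin
    (a · pw a k) · pw b (suc k)   ≡⟨ cong ((a · pw a k) ·_) (pw-suc′ b k) ⟩
    (a · pw a k) · (pw b k · b)   ≡⟨ assoc _ _ _ ⟩
    a · (pw a k · (pw b k · b))   ≡⟨ cong (a ·_) (sym (assoc _ _ _)) ⟩
    a · ((pw a k · pw b k) · b)   ≡⟨ cong (λ z → a · (z · b)) (pw-inverse a b h k) ⟩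
    a · (e · b)                   ≡⟨ cong (a ·_) (identityˡ b) ⟩
    a · b                         ≡⟨ h ⟩
    e                             ∎

  pw-intertwine : ∀ a b c → c · a ≡ b · c → ∀ k → c · pw a k ≡ pw b k · c
  pw-intertwine a b c h zero = trans (identityʳ c) (sym (identityˡ c))
  pw-intertwine a b c h (suc k) = begin
    c · (a · pw a k)   ≡⟨ sym (assoc _ _ _) ⟩
    (c · a) · pw a k   ≡⟨ cong (_· pw a k) h ⟩
    (b · c) · pw a k   ≡⟨ assoc _ _ _ ⟩
    b · (c · pw a k)   ≡⟨ cong (b ·_) (pw-intertwine a b c h k) ⟩
    b · (pw b k · c)   ≡⟨ sym (assoc _ _ _) ⟩
    (b · pw b k) · c   ∎

  xorSum : (ℕ → Bool) → ℕ → Bool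
  xorSum f zero = false
  xorSum f (suc l) = xorSum f l xor f l

  xorSum-cong : ∀ f g → (∀ x → f x ≡ g x) → ∀ l → xorSum f l ≡ xorSum g l
  xorSum-cong f g h zero = refl
  xorSum-cong f g h (suc l) = cong₂ _xor_ (xorSum-cong f g h l) (h l)

  xorSum-+ : ∀ f m l → xorSum f (m + l) ≡ xorSum f m xor xorSum (λ x → f (m + x)) l
  xorSum-+ f m zero = trans (cong (xorSum f) (+-identityʳ m)) (sym (xor-identityʳ _))
  xorSum-+ f m (suc l) rewrite +-suc m l | xorSum-+ f m l = xor-assoc (xorSum f m) _ _

  xorSum-two-periods : ∀ f m → (∀ x → f (m + x) ≡ f x) → xorSum f (m + m) ≡ false
  xorSum-two-periods f m h =
    trans (xorSum-+ f m m) (trans (cong (xorSum f m xor_) (xorSum-cong _ _ h m)) (xor-same (xorSum f m)))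

  solve-conj : ∀ c d t u → d · c ≡ e → c · (t · d) ≡ u → t ≡ d · (u · c)
  solve-conj c d t u dc p = begin
    t                          ≡⟨ sym (identityˡ t) ⟩
    e · t                      ≡⟨ cong (_· t) (sym dc) ⟩
    (d · c) · t                ≡⟨ assoc _ _ _ ⟩
    d · (c · t)                ≡⟨ cong (d ·_) (sym (identityʳ _)) ⟩
    d · ((c · t) · e)          ≡⟨ cong (λ z → d · ((c · t) · z)) (sym dc) ⟩
    d · ((c · t) · (d · c))    ≡⟨ cong (d ·_) (sym (assoc _ _ _)) ⟩
    d · (((c · t) · d) · c)    ≡⟨ cong (λ z → d · (z · c)) (trans (assoc _ _ _) p) ⟩
    d · (u · c)                ∎

  unsolve-conj : ∀ c d t u → c · d ≡ e → t ≡ d · (u · c) → c · (t · d) ≡ u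
  unsolve-conj c d t u cd p = begin
    c · (t · d)               ≡⟨ cong (λ z → c · (z · d)) p ⟩
    c · ((d · (u · c)) · d)   ≡⟨ cong (c ·_) (assoc _ _ _) ⟩
    c · (d · ((u · c) · d))   ≡⟨ inv-cancel-pair ⟩
    (u · c) · d               ≡⟨ assoc _ _ _ ⟩
    u · (c · d)               ≡⟨ cong (u ·_) cd ⟩
    u · e                     ≡⟨ identityʳ u ⟩
    u                         ∎
    where
      inv-cancel-pair : c · (d · ((u · c) · d)) ≡ (u · c) · d
      inv-cancel-pair = trans (sym (assoc _ _ _)) (trans (cong (_· ((u · c) · d)) cd) (identityˡ _))

  -- Writing G = sᵢ sⱼ and
  -- G′ = sⱼ sᵢ = G⁻¹, the k-th power of ηᵢηⱼ conjugates by Gᵏ and adds the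
  -- deltas [t = G′ˡ sⱼ] for l < 2k; for k = m i j both contributions vanish.
  module Dihedral (i j : Fin n) where
    G G′ : W
    G = s i · s j
    G′ = s j · s i

    G·G′ : G · G′ ≡ e
    G·G′ = trans (assoc _ _ _) (trans (cong (s i ·_) (s-cancelˡ (s i) j)) (s-square i))

    G′·G : G′ · G ≡ e
    G′·G = trans (assoc _ _ _) (trans (cong (s j ·_) (s-cancelˡ (s j) i)) (s-square j))

    Gᵏ·G′ᵏ : ∀ k → pw G k · pw G′ k ≡ e
    Gᵏ·G′ᵏ = pw-inverse G G′ G·G′

    G′ᵏ·Gᵏ : ∀ k → pw G′ k · pw G k ≡ e
    G′ᵏ·Gᵏ = pw-inverse G′ G G′·G

    sⱼGᵏ : ∀ k → s j · pw G k ≡ pw G′ k · s j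
    sⱼGᵏ = pw-intertwine G G′ (s j) (sym (assoc _ _ _))

    powP : ℕ → Perm
    powP k = pow _∘P_ idP (ηP i ∘P ηP j) k

    δ-term : W → ℕ → Bool
    δ-term t l = δ t (pw G′ l · s j)

    even-index : ∀ k → pw G′ k · (s j · pw G k) ≡ pw G′ (k + k) · s j
    even-index k = begin
      pw G′ k · (s j · pw G k)     ≡⟨ cong (pw G′ k ·_) (sⱼGᵏ k) ⟩
      pw G′ k · (pw G′ k · s j)    ≡⟨ sym (assoc _ _ _) ⟩
      (pw G′ k · pw G′ k) · s j    ≡⟨ cong (_· s j) (sym (pw-+ G′ k k)) ⟩
      pw G′ (k + k) · s j          ∎

    sⱼsᵢsⱼ : conj (s j) (s i) ≡ G′ · s j
    sⱼsᵢsⱼ = trans (cong (λ z → s j · (s i · z)) (s-inv j)) (sym (assoc _ _ _))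

    odd-index : ∀ k → pw G′ k · (conj (s j) (s i) · pw G k) ≡ pw G′ (suc (k + k)) · s j
    odd-index k = begin
      pw G′ k · (conj (s j) (s i) · pw G k) ≡⟨ cong (λ z → pw G′ k · (z · pw G k)) sⱼsᵢsⱼ ⟩
      pw G′ k · ((G′ · s j) · pw G k)       ≡⟨ cong (pw G′ k ·_) (assoc _ _ _) ⟩
      pw G′ k · (G′ · (s j · pw G k))       ≡⟨ sym (assoc _ _ _) ⟩
      (pw G′ k · G′) · (s j · pw G k)       ≡⟨ cong (_· (s j · pw G k)) (sym (pw-suc′ G′ k)) ⟩
      pw G′ (suc k) · (s j · pw G k)        ≡⟨ cong (pw G′ (suc k) ·_) (sⱼGᵏ k) ⟩
      pw G′ (suc k) · (pw G′ k · s j)       ≡⟨ sym (assoc _ _ _) ⟩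
      (pw G′ (suc k) · pw G′ k) · s j       ≡⟨ cong (_· s j) (sym (pw-+ G′ (suc k) k)) ⟩
      pw G′ (suc (k + k)) · s j             ∎

    δ-even : ∀ t k → δ (pw G k · (t · pw G′ k)) (s j) ≡ δ-term t (k + k)
    δ-even t k = δ-cong
      (λ h → trans (solve-conj (pw G k) (pw G′ k) t (s j) (G′ᵏ·Gᵏ k) h) (even-index k))
      (λ h → unsolve-conj (pw G k) (pw G′ k) t (s j) (Gᵏ·G′ᵏ k) (trans h (sym (even-index k))))

    δ-odd : ∀ t k → δ (conj (s j) (pw G k · (t · pw G′ k))) (s i) ≡ δ-term t (suc (k + k))
    δ-odd t k = δ-cong
      (λ h → trans (solve-conj (pw G k) (pw G′ k) t V (G′ᵏ·Gᵏ k)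
                (conj-injective (s j) _ V (trans h (sym (conj-s-cancel j (s i)))))) (odd-index k))
      (λ h → trans (cong (conj (s j)) (unsolve-conj (pw G k) (pw G′ k) t V (Gᵏ·G′ᵏ k) (trans h (sym (odd-index k)))))
                   (conj-s-cancel j (s i)))
      where V = conj (s j) (s i)

    conj-step : ∀ t k → conj (s i) (conj (s j) (pw G k · (t · pw G′ k))) ≡ pw G (suc k) · (t · pw G′ (suc k))
    conj-step t k = begin
      conj (s i) (conj (s j) (pw G k · (t · pw G′ k)))  ≡⟨ conj-comp _ _ _ ⟩
      G · ((pw G k · (t · pw G′ k)) · (G ⁻¹))          ≡⟨ cong (λ z → G · ((pw G k · (t · pw G′ k)) · z)) G⁻¹≡G′ ⟩
      G · ((pw G k · (t · pw G′ k)) · G′)              ≡⟨ cong (G ·_) (assoc _ _ _) ⟩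
      G · (pw G k · ((t · pw G′ k) · G′))              ≡⟨ sym (assoc _ _ _) ⟩
      pw G (suc k) · ((t · pw G′ k) · G′)              ≡⟨ cong (pw G (suc k) ·_) (assoc _ _ _) ⟩
      pw G (suc k) · (t · (pw G′ k · G′))              ≡⟨ cong (λ z → pw G (suc k) · (t · z)) (sym (pw-suc′ G′ k)) ⟩
      pw G (suc k) · (t · pw G′ (suc k))               ∎
      where
        G⁻¹≡G′ : G ⁻¹ ≡ G′
        G⁻¹≡G′ = sym (inv-unique G G′ G·G′)

    powP-action : ∀ k t b → fw (powP k) (t , b) ≡ (pw G k · (t · pw G′ k) , b xor xorSum (δ-term t) (k + k))
    powP-action zero t b = cong₂ _,_ (sym (trans (identityˡ _) (identityʳ t))) (sym (xor-identityʳ b))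
    powP-action (suc k) t b rewrite powP-action k t b | +-suc k k =
      cong₂ _,_ (conj-step t k)
        (trans (cong₂ (λ x y → ((b xor S) xor x) xor y) (δ-even t k) (δ-odd t k))
          (trans (xor-assoc (b xor S) (δ-term t (k + k)) (δ-term t (suc (k + k))))
            (trans (xor-assoc b S (δ-term t (k + k) xor δ-term t (suc (k + k))))
               (cong (b xor_) (sym (xor-assoc S (δ-term t (k + k)) (δ-term t (suc (k + k)))))))))
      where S = xorSum (δ-term t) (k + k)

    dihedral-relation : powP (m i j) ≈P idP
    dihedral-relation (t , b) = trans (powP-action (m i j) t b) (cong₂ _,_ conj-trivial parity-trivial)
      where
        Gᵐ : pw G (m i j) ≡ e
        Gᵐ = relations i j
        G′ᵐ : pw G′ (m i j) ≡ e
        G′ᵐ = trans (sym (identityˡ _)) (trans (cong (_· pw G′ (m i j)) (sym Gᵐ)) (Gᵏ·G′ᵏ (m i j)))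
        conj-trivial : pw G (m i j) · (t · pw G′ (m i j)) ≡ t
        conj-trivial rewrite Gᵐ | G′ᵐ = trans (identityˡ _) (identityʳ t)
        periodic : ∀ x → δ-term t (m i j + x) ≡ δ-term t x
        periodic x = cong (λ z → δ t (z · s j))
          (trans (pw-+ G′ (m i j) x) (trans (cong (_· pw G′ x) G′ᵐ) (identityˡ _)))
        parity-trivial : b xor xorSum (δ-term t) (m i j + m i j) ≡ b
        parity-trivial = trans (cong (b xor_) (xorSum-two-periods (δ-term t) (m i j) periodic)) (xor-identityʳ b)

  private
    action = universal PermGroup ηP (λ i j → Dihedral.dihedral-relation i j)

  φ : W → Perm
  φ = proj₁ action

  φ-hom : ∀ a b → φ (a · b) ≈P (φ a ∘P φ b)
  φ-hom = proj₁ (proj₂ action)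

  φ-e : φ e ≈P idP
  φ-e x = begin
    fw (φ e) x                         ≡⟨ sym (cong (fw (φ e)) (fw-bw (φ e) x)) ⟩
    fw (φ e) (fw (φ e) (bw (φ e) x))   ≡⟨ sym (φ-hom e e (bw (φ e) x)) ⟩
    fw (φ (e · e)) (bw (φ e) x)        ≡⟨ cong (λ z → fw (φ z) (bw (φ e) x)) (identityˡ e) ⟩
    fw (φ e) (bw (φ e) x)              ≡⟨ fw-bw (φ e) x ⟩
    x                                  ∎

  φ-eval : ∀ a → φ (eval a) ≈P permOf a
  φ-eval [] = φ-e
  φ-eval (i ∷ a) x = trans (φ-hom (s i) (eval a) x)
    (trans (proj₂ (proj₂ action) i _) (cong (η i) (φ-eval a x)))

  N : W → W → Bool
  N w t = proj₂ (fw (φ w) (t , false))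

  N-parity : ∀ a t → N (eval a) t ≡ parity a t
  N-parity a t = cong proj₂ (trans (φ-eval a (t , false)) (permOf-action a t false))

  N-action : ∀ w t b → fw (φ w) (t , b) ≡ (conj w t , b xor N w t)
  N-action w t b with generates w
  ... | a , refl = trans (φ-eval a (t , b)) (trans (permOf-action a t b)
        (cong (λ z → (conj (eval a) t , b xor z)) (sym (N-parity a t))))

  cocycle : ∀ w v t → N (w · v) t ≡ N v t xor N w (conj v t)
  cocycle w v t = begin
    N (w · v) t                               ≡⟨ cong proj₂ (φ-hom w v (t , false)) ⟩
    proj₂ (fw (φ w) (fw (φ v) (t , false)))   ≡⟨ cong (λ z → proj₂ (fw (φ w) z)) (N-action v t false) ⟩
    proj₂ (fw (φ w) (conj v t , N v t))       ≡⟨ cong proj₂ (N-action w (conj v t) (N v t)) ⟩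
    N v t xor N w (conj v t)                  ∎

  N-e : ∀ t → N e t ≡ false
  N-e t = N-parity [] t

  N-s : ∀ i t → N (s i) t ≡ δ t (s i)
  N-s i t = trans (cong (λ z → N z t) (sym (identityʳ (s i)))) (trans (N-parity [ i ] t) (cong (λ z → δ z (s i)) (conj-e t)))

-- For a reflection
-- t, N w t holds iff t is a right descent of w in the sense ℓ(wt) < ℓ(w);
-- this rests on the deletion property of the parity of a word.
module Inversions (C : CoxeterSystem) where
  open CoxeterSystem C
  open Coxeter C
  open GroupBasics C
  open ReflectionCocycle C
  open ≡-Reasoning

  xor-false : ∀ a b → a xor b ≡ false → b ≡ a
  xor-false false false h = refl
  xor-false true true h = refl

  true≢false : true ≡ false → ⊥
  true≢false ()

  Reflection : W → Set
  Reflection t = Σ W λ v → Σ (Fin n) λ i → t ≡ conj v (s i)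

  s-reflection : ∀ i → Reflection (s i)
  s-reflection i = e , i , sym (conj-e (s i))

  parity-deletion : ∀ a t → parity a t ≡ true → Σ (List (Fin n)) λ p → Σ (Fin n) λ i → Σ (List (Fin n)) λ q →
                    (a ≡ p ++ i ∷ q) × (eval a · t ≡ eval (p ++ q))
  parity-deletion [] t ()
  parity-deletion (i ∷ a) t h with δ (conj (eval a) t) (s i) in eq
  ... | true = [] , i , a , refl , (begin
        (s i · eval a) · t                         ≡⟨ assoc _ _ _ ⟩
        s i · (eval a · t)                         ≡⟨ cong (s i ·_) (sym (inv-cancelʳ′ _ (eval a))) ⟩
        s i · (((eval a · t) · (eval a ⁻¹)) · eval a) ≡⟨ cong (λ z → s i · (z · eval a)) (trans (assoc _ _ _) (δ-true eq)) ⟩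
        s i · (s i · eval a)                       ≡⟨ s-cancelˡ (eval a) i ⟩
        eval a                                     ∎)
  ... | false with parity-deletion a t (trans (sym (xor-identityʳ (parity a t))) h)
  ... | p , k , q , refl , ev = i ∷ p , k , q , refl , trans (assoc _ _ _) (cong (s i ·_) ev)

  inversion-deletion : ∀ w t → N w t ≡ true → ∀ a → eval a ≡ w → Σ (List (Fin n)) λ p → Σ (Fin n) λ i → Σ (List (Fin n)) λ q →
                       (a ≡ p ++ i ∷ q) × (w · t ≡ eval (p ++ q))
  inversion-deletion _ t h a refl = parity-deletion a t (trans (sym (N-parity a t)) h)

  deleted-letter : ∀ p i q t → eval (p ++ i ∷ q) · t ≡ eval (p ++ q) → t ≡ conj (eval q ⁻¹) (s i)
  deleted-letter p i q t h = begin
      t                                          ≡⟨ sym (inv-cancelˡ (s i · eval q) t) ⟩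
      ((s i · eval q) ⁻¹) · ((s i · eval q) · t) ≡⟨ cong (((s i · eval q) ⁻¹) ·_) siq·t ⟩
      ((s i · eval q) ⁻¹) · eval q               ≡⟨ cong (_· eval q) (inv-sw (eval q) i) ⟩
      ((eval q ⁻¹) · s i) · eval q               ≡⟨ assoc _ _ _ ⟩
      (eval q ⁻¹) · (s i · eval q)               ≡⟨ cong (λ z → (eval q ⁻¹) · (s i · z)) (sym (inv-inv (eval q))) ⟩
      conj (eval q ⁻¹) (s i)                     ∎
    where
      siq·t : (s i · eval q) · t ≡ eval q
      siq·t = cancelˡ (eval p) _ _ (begin
        eval p · ((s i · eval q) · t) ≡⟨ sym (assoc _ _ _) ⟩
        (eval p · (s i · eval q)) · t ≡⟨ cong (_· t) (sym (eval-++ p (i ∷ q))) ⟩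
        eval (p ++ i ∷ q) · t         ≡⟨ h ⟩
        eval (p ++ q)                 ≡⟨ eval-++ p q ⟩
        eval p · eval q               ∎)

  inversion⇒descent : ∀ w t → N w t ≡ true → ℓ (w · t) < ℓ w
  inversion⇒descent w t h with ℓ-attained w
  ... | a , ea , la with inversion-deletion w t h a ea
  ... | p , i , q , refl , ev =
    ≤-<-trans (≤-trans (≤-reflexive (cong ℓ ev)) (ℓ-word (p ++ q)))
      (subst₂ _<_ (sym (length-++ p)) (trans (sym (length-++ p)) la) (+-monoʳ-< (length p) (n<1+n (length q))))

  inversion⇒reflection : ∀ w t → N w t ≡ true → Reflection t
  inversion⇒reflection w t h with generates w
  ... | a , ea with inversion-deletion w t h a ea
  ... | p , i , q , refl , ev = (eval q ⁻¹) , i , deleted-letter p i q t (trans (cong (_· t) ea) ev)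

  inversion-in-parabolic : ∀ J w t → InParabolic J w → N w t ≡ true → InParabolic J t
  inversion-in-parabolic J w t (a , a∈ , ea) h with inversion-deletion w t h a ea
  ... | p , i , q , refl , ev with ++⁻ʳ p a∈
  ... | i∈ ∷ q∈ = subst (InParabolic J) (sym (deleted-letter p i q t (trans (cong (_· t) ea) ev)))
                    (parabolic-conj J (eval q ⁻¹) (s i) (parabolic-inv J _ (q , q∈ , refl)) (parabolic-s J i i∈))

  N-inv : ∀ w t → N (w ⁻¹) (conj w t) ≡ N w t
  N-inv w t = xor-false (N w t) _ (trans (sym (cocycle (w ⁻¹) w t)) (trans (cong (λ z → N z t) (inverseˡ w)) (N-e t)))

  N-s-self : ∀ i → N (s i) (s i) ≡ true
  N-s-self i = trans (N-s i (s i)) (δ-refl (s i))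

  reflection-square : ∀ t → Reflection t → t · t ≡ e
  reflection-square t (v , i , refl) = trans (conj-mul v (s i) (s i)) (trans (cong (conj v) (s-square i)) (conj-of-e v))

  reflection-self-inversion : ∀ t → Reflection t → N t t ≡ true
  reflection-self-inversion t (v , i , refl) = begin
    N (conj v (s i)) (conj v (s i))          ≡⟨ cong (λ z → N z (conj v (s i))) (sym (assoc _ _ _)) ⟩
    N ((v · s i) · (v ⁻¹)) (conj v (s i))    ≡⟨ cocycle (v · s i) (v ⁻¹) _ ⟩
    N (v ⁻¹) (conj v (s i)) xor N (v · s i) (conj (v ⁻¹) (conj v (s i)))
                                             ≡⟨ cong₂ _xor_ (N-inv v (s i)) (cong (N (v · s i)) (conj-cancel v (s i))) ⟩
    N v (s i) xor N (v · s i) (s i)          ≡⟨ cong (N v (s i) xor_) (cocycle v (s i) (s i)) ⟩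
    N v (s i) xor (N (s i) (s i) xor N v (conj (s i) (s i)))
                                             ≡⟨ cong₂ (λ x y → N v (s i) xor (x xor N v y)) (N-s-self i) (conj-self (s i)) ⟩
    N v (s i) xor (true xor N v (s i))       ≡⟨ xor-inverseʳ (N v (s i)) ⟩
    true                                     ∎

  non-inversion⇒ascent : ∀ w t → Reflection t → N w t ≡ false → ℓ w < ℓ (w · t)
  non-inversion⇒ascent w t rt h =
    subst (_< ℓ (w · t)) (cong ℓ (trans (assoc _ _ _) (trans (cong (w ·_) (reflection-square t rt)) (identityʳ w))))
      (inversion⇒descent (w · t) t (begin
        N (w · t) t              ≡⟨ cocycle w t t ⟩
        N t t xor N w (conj t t) ≡⟨ cong₂ (λ x y → x xor N w y) (reflection-self-inversion t rt) (conj-self t) ⟩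
        true xor N w t           ≡⟨ cong (true xor_) h ⟩
        true                     ∎))

  descent⇒inversion : ∀ w t → Reflection t → ℓ (w · t) < ℓ w → N w t ≡ true
  descent⇒inversion w t rt h with N w t in eq
  ... | true = refl
  ... | false = ⊥-elim (<-asym h (non-inversion⇒ascent w t rt eq))

  ascent⇒non-inversion : ∀ w t → ℓ w < ℓ (w · t) → N w t ≡ false
  ascent⇒non-inversion w t h with N w t in eq
  ... | true = ⊥-elim (<-asym h (inversion⇒descent w t eq))
  ... | false = refl

  ℓ-s : ∀ i → ℓ (s i) ≡ 1
  ℓ-s i = ≤-antisym (ℓ-s≤1 i) (subst (_< ℓ (s i)) ℓ-e (subst (λ z → ℓ z < ℓ (s i)) (s-square i) (inversion⇒descent (s i) (s i) (N-s-self i))))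

  no-descent⇒minRep : ∀ J x → (∀ i → i ∈ J → ¬ RightDescent x i) → MinimalRep J x
  no-descent⇒minRep J x nd i i∈ with N x (s i) in eq
  ... | true = ⊥-elim (nd i i∈ (inversion⇒descent x (s i) eq))
  ... | false = non-inversion⇒ascent x (s i) (s-reflection i) eq

  N-product : ∀ x g r → N ((x · g) ⁻¹) (conj x r) ≡ N x r xor N (g ⁻¹) r
  N-product x g r = begin
    N ((x · g) ⁻¹) (conj x r)                        ≡⟨ cong (λ z → N z (conj x r)) (inv-mul x g) ⟩
    N ((g ⁻¹) · (x ⁻¹)) (conj x r)                   ≡⟨ cocycle (g ⁻¹) (x ⁻¹) (conj x r) ⟩
    N (x ⁻¹) (conj x r) xor N (g ⁻¹) (conj (x ⁻¹) (conj x r))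
                                                     ≡⟨ cong₂ _xor_ (N-inv x r) (cong (N (g ⁻¹)) (conj-cancel x r)) ⟩
    N x r xor N (g ⁻¹) r                             ∎

  N-product′ : ∀ x g t → N ((x · g) ⁻¹) t ≡ N x (conj (x ⁻¹) t) xor N (g ⁻¹) (conj (x ⁻¹) t)
  N-product′ x g t = trans (cong (N ((x · g) ⁻¹)) (sym (conj-cancel′ x t))) (N-product x g (conj (x ⁻¹) t))

  N-inv′ : ∀ x t → N (x ⁻¹) t ≡ N x (conj (x ⁻¹) t)
  N-inv′ x t = trans (cong (N (x ⁻¹)) (sym (conj-cancel′ x t))) (N-inv x (conj (x ⁻¹) t))

  N-s-inv : ∀ j r → N (s j ⁻¹) r ≡ δ r (s j)
  N-s-inv j r = trans (cong (λ z → N z r) (s-inv j)) (N-s j r)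

module WeakOrder (C : CoxeterSystem) where
  open CoxeterSystem C
  open Coxeter C
  open GroupBasics C
  open ReflectionCocycle C
  open Inversions C
  open ≡-Reasoning

  ≤w-refl : ∀ u → u ≤w u
  ≤w-refl u = trans (cong (ℓ u +_) (trans (cong ℓ (inverseˡ u)) ℓ-e)) (+-identityʳ (ℓ u))

  ≤w-length : ∀ u v → u ≤w v → ℓ u ≤ ℓ v
  ≤w-length u v h = subst (ℓ u ≤_) h (m≤m+n (ℓ u) _)

  meet-of-comparable : ∀ a b → b ≤w a → IsMeet a b b
  meet-of-comparable a b b≤a = b≤a , ≤w-refl b , λ u _ u≤b → u≤b

  join-of-comparable : ∀ a b → a ≤w b → IsJoin a b b
  join-of-comparable a b a≤b = a≤b , ≤w-refl b , λ u _ b≤u → b≤u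

  descent-≤w : ∀ w i → ℓ (w · s i) < ℓ w → (w · s i) ≤w w
  descent-≤w w i d = trans (cong (ℓ (w · s i) +_) (trans (cong ℓ ws⁻¹w) (ℓ-s i)))
                       (trans (+-comm (ℓ (w · s i)) 1) (≤-antisym d (ℓ-w≤ w i)))
    where
      ws⁻¹w : ((w · s i) ⁻¹) · w ≡ s i
      ws⁻¹w = trans (cong (_· w) (inv-ws w i)) (trans (assoc _ _ _) (trans (cong (s i ·_) (inverseˡ w)) (identityʳ _)))

  inversions-up-step : ∀ u i t → ℓ (u · s i) ≡ suc (ℓ u) → N (u ⁻¹) t ≡ true → N ((u · s i) ⁻¹) t ≡ true
  inversions-up-step u i t up hn = begin
      N ((u · s i) ⁻¹) t                   ≡⟨ cong (λ z → N z t) (inv-ws u i) ⟩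
      N (s i · (u ⁻¹)) t                   ≡⟨ cocycle (s i) (u ⁻¹) t ⟩
      N (u ⁻¹) t xor N (s i) (conj (u ⁻¹) t) ≡⟨ cong₂ _xor_ hn (N-s i _) ⟩
      true xor δ (conj (u ⁻¹) t) (s i)      ≡⟨ cong (true xor_) (not-new _ refl) ⟩
      true                                  ∎
    where
      -- u⁻¹ t u = sᵢ would give u⁻¹ t = (u sᵢ)⁻¹, which is longer than u⁻¹
      -- although t shortens u⁻¹.
      not-new : ∀ b → δ (conj (u ⁻¹) t) (s i) ≡ b → b ≡ false
      not-new false _ = refl
      not-new true eq = ⊥-elim (<-irrefl refl (<-trans too-short (subst (ℓ u <_) (sym up) (n<1+n _))))
        where
          u⁻¹t≡ : (u ⁻¹) · t ≡ (u · s i) ⁻¹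
          u⁻¹t≡ = trans (sym (conj-back (u ⁻¹) t)) (trans (cong (_· (u ⁻¹)) (δ-true eq)) (sym (inv-ws u i)))
          too-short : ℓ (u · s i) < ℓ u
          too-short = subst₂ _<_ (trans (cong ℓ u⁻¹t≡) (ℓ-inv _)) (ℓ-inv u) (inversion⇒descent (u ⁻¹) t hn)

  inversions-up-word : ∀ a u t → ℓ (u · eval a) ≡ ℓ u + length a → N (u ⁻¹) t ≡ true → N ((u · eval a) ⁻¹) t ≡ true
  inversions-up-word [] u t _ hn = subst (λ z → N (z ⁻¹) t ≡ true) (sym (identityʳ u)) hn
  inversions-up-word (i ∷ a) u t hl hn = subst (λ z → N (z ⁻¹) t ≡ true) (assoc u (s i) (eval a))
      (inversions-up-word a (u · s i) t hl₂ (inversions-up-step u i t hl₁ hn))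
    where
      L = ℓ ((u · s i) · eval a)
      hL : L ≡ suc (ℓ u + length a)
      hL = trans (cong ℓ (assoc _ _ _)) (trans hl (+-suc (ℓ u) (length a)))
      upper : L ≤ ℓ (u · s i) + length a
      upper = ≤-trans (ℓ-mul _ _) (+-monoʳ-≤ (ℓ (u · s i)) (ℓ-word a))
      hl₁ : ℓ (u · s i) ≡ suc (ℓ u)
      hl₁ = ≤-antisym (ℓ-ws≤ u i) (+-cancelʳ-≤ (length a) _ _ (subst (_≤ ℓ (u · s i) + length a) hL upper))
      hl₂ : L ≡ ℓ (u · s i) + length a
      hl₂ = trans hL (cong (_+ length a) (sym hl₁))

  inversions-mono : ∀ u w → u ≤w w → ∀ t → N (u ⁻¹) t ≡ true → N (w ⁻¹) t ≡ true
  inversions-mono u w h t hn with ℓ-attained ((u ⁻¹) · w)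
  ... | a , ea , la = subst (λ z → N (z ⁻¹) t ≡ true) u·a≡w (inversions-up-word a u t hl hn)
    where
      u·a≡w : u · eval a ≡ w
      u·a≡w = trans (cong (u ·_) ea) (inv-cancelˡ′ u w)
      hl : ℓ (u · eval a) ≡ ℓ u + length a
      hl = trans (cong ℓ u·a≡w) (trans (sym h) (cong (ℓ u +_) (sym la)))

  drop-last-letter : ∀ k u → ℓ u ≡ suc k → Σ W λ u′ → Σ (Fin n) λ j → (u ≡ u′ · s j) × ℓ u′ ≡ k
  drop-last-letter k u hk with ℓ-attained u
  ... | [] , _ , la = ⊥-elim (0≢1+n (trans la hk))
  ... | (i ∷ a) , ea , la with last-letter i a
  ... | p , j , eqa = eval p , j , u≡ , ≤-antisym ℓp≤k (s≤s⁻¹ k<ℓp)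
    where
      u≡ : u ≡ eval p · s j
      u≡ = trans (sym ea) (trans (cong eval eqa) (eval-snoc p j))
      len-p : suc (length p) ≡ suc k
      len-p = trans (trans (sym (+-comm (length p) 1)) (sym (length-++ p {[ j ]}))) (trans (cong length (sym eqa)) (trans la hk))
      ℓp≤k : ℓ (eval p) ≤ k
      ℓp≤k = subst (ℓ (eval p) ≤_) (suc-injective len-p) (ℓ-word p)
      k<ℓp : suc k ≤ suc (ℓ (eval p))
      k<ℓp = subst (_≤ suc (ℓ (eval p))) (trans (cong ℓ (sym u≡)) hk) (ℓ-ws≤ (eval p) j)

  new-left-inversion : ∀ u′ j → ℓ u′ < ℓ (u′ · s j) → N ((u′ · s j) ⁻¹) (conj u′ (s j)) ≡ true
  new-left-inversion u′ j asc =
    trans (N-product u′ (s j) (s j)) (cong₂ _xor_ (ascent⇒non-inversion u′ (s j) asc) (trans (N-s-inv j (s j)) (δ-refl _)))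

  extend-below : ∀ u′ j w → u′ ≤w w → ℓ (u′ · s j) ≡ suc (ℓ u′) → N (w ⁻¹) (conj u′ (s j)) ≡ true → (u′ · s j) ≤w w
  extend-below u′ j w u′≤w up hw = begin
      ℓ (u′ · s j) + ℓ (((u′ · s j) ⁻¹) · w) ≡⟨ cong₂ _+_ up (cong ℓ (trans (cong (_· w) (inv-ws u′ j)) (assoc _ _ _))) ⟩
      suc (ℓ u′) + ℓ (s j · y)                ≡⟨ sym (+-suc (ℓ u′) _) ⟩
      ℓ u′ + suc (ℓ (s j · y))                ≡⟨ cong (ℓ u′ +_) (≤-antisym sy<y (ℓ-w≤′ y j)) ⟩
      ℓ u′ + ℓ y                              ≡⟨ u′≤w ⟩
      ℓ w                                     ∎
    where
      y = (u′ ⁻¹) · w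
      asc : N u′ (s j) ≡ false
      asc = ascent⇒non-inversion u′ (s j) (subst (ℓ u′ <_) (sym up) (n<1+n _))
      -- the inversion of w is not one of u′, so it comes from y: sⱼ is a left descent of y
      y⁻¹-inverts : N (y ⁻¹) (s j) ≡ true
      y⁻¹-inverts = trans (sym (cong (_xor N (y ⁻¹) (s j)) asc))
                      (trans (sym (N-product u′ y (s j))) (trans (cong (λ z → N (z ⁻¹) (conj u′ (s j))) (inv-cancelˡ′ u′ w)) hw))
      sy<y : ℓ (s j · y) < ℓ y
      sy<y = subst₂ _<_ (sym (ℓ-sw≡ℓ-inv-s y j)) (ℓ-inv y) (inversion⇒descent (y ⁻¹) (s j) y⁻¹-inverts)

  inversions-anti-length : ∀ k u w → ℓ u ≡ k → (∀ t → N (u ⁻¹) t ≡ true → N (w ⁻¹) t ≡ true) → u ≤w w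
  inversions-anti-length zero u w hk _ with ℓ≡0⇒e u hk
  ... | refl = trans (cong (_+ ℓ ((e ⁻¹) · w)) hk) (cong ℓ (trans (cong (_· w) inv-e) (identityˡ w)))
  inversions-anti-length (suc k) u w hk incl with drop-last-letter k u hk
  ... | u′ , j , refl , ℓu′ = extend-below u′ j w u′≤w up (incl _ (new-left-inversion u′ j (subst (ℓ u′ <_) (sym up) (n<1+n _))))
    where
      up : ℓ (u′ · s j) ≡ suc (ℓ u′)
      up = trans hk (cong suc (sym ℓu′))
      u′≤w : u′ ≤w w
      u′≤w = inversions-anti-length k u′ w ℓu′ (λ t h → incl t (inversions-up-step u′ j t up h))

  inversions-anti : ∀ u w → (∀ t → N (u ⁻¹) t ≡ true → N (w ⁻¹) t ≡ true) → u ≤w w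
  inversions-anti u w = inversions-anti-length (ℓ u) u w refl

module Parabolic (C : CoxeterSystem) where
  open CoxeterSystem C
  open Coxeter C
  open GroupBasics C
  open ReflectionCocycle C
  open Inversions C
  open WeakOrder C
  open ≡-Reasoning

  reduced-parabolic-word : ∀ J b → All (λ i → i ∈ J) b → Σ (List (Fin n)) λ c →
                           All (λ i → i ∈ J) c × eval c ≡ eval b × length c ≡ ℓ (eval b)
  reduced-parabolic-word J [] [] = [] , [] , refl , sym ℓ-e
  reduced-parabolic-word J (i ∷ b₀) (i∈ ∷ b₀∈) with reduced-parabolic-word J b₀ b₀∈
  ... | c₀ , c₀∈ , ec₀ , ℓc₀ with N (eval b₀ ⁻¹) (s i) in eqN
  ... | false = i ∷ c₀ , i∈ ∷ c₀∈ , cong (s i ·_) ec₀ , ≤-antisym (s≤s⁻¹ longer) shorter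
    where
      u₀ = eval b₀
      -- sᵢ is not a left descent of u₀, so sᵢ u₀ is longer
      longer : suc (length (i ∷ c₀)) ≤ suc (ℓ (s i · u₀))
      longer = s≤s (subst (_≤ ℓ (s i · u₀)) (cong suc (sym ℓc₀))
                 (subst₂ _<_ (ℓ-inv u₀) (sym (ℓ-sw≡ℓ-inv-s u₀ i)) (non-inversion⇒ascent (u₀ ⁻¹) (s i) (s-reflection i) eqN)))
      shorter : ℓ (s i · u₀) ≤ length (i ∷ c₀)
      shorter = subst (λ z → ℓ (s i · z) ≤ suc (length c₀)) ec₀ (ℓ-word (i ∷ c₀))
  ... | true with inversion-deletion (eval b₀ ⁻¹) (s i) eqN (reverse c₀) (trans (eval-reverse c₀) (cong _⁻¹ ec₀))
  ... | p , k , q , eqr , ev = reverse (p ++ q) , All-reverse (p ++ q) pq∈ , value , len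
    where
      -- sᵢ is a left descent of u₀: deleting a letter of a reduced word of u₀⁻¹ gives (sᵢ u₀)⁻¹
      u₀ = eval b₀
      pkq∈ : All (λ i → i ∈ J) (p ++ k ∷ q)
      pkq∈ = subst (All (λ i → i ∈ J)) eqr (All-reverse c₀ c₀∈)
      pq∈ : All (λ i → i ∈ J) (p ++ q)
      pq∈ with ++⁻ʳ p pkq∈
      ... | _ ∷ q∈ = ++⁺ (++⁻ˡ p pkq∈) q∈
      value : eval (reverse (p ++ q)) ≡ s i · u₀
      value = trans (eval-reverse (p ++ q)) (trans (cong _⁻¹ (sym ev)) (trans (inv-mul _ _)
                (cong₂ _·_ (s-inv i) (inv-inv u₀))))
      len-pkq : suc (length (p ++ q)) ≡ ℓ u₀
      len-pkq = trans (cong suc (length-++ p)) (trans (sym (+-suc (length p) (length q)))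
                 (trans (sym (length-++ p)) (trans (cong length (sym eqr)) (trans (length-reverse c₀) ℓc₀))))
      len : length (reverse (p ++ q)) ≡ ℓ (s i · u₀)
      len = trans (length-reverse (p ++ q)) (≤-antisym
              (s≤s⁻¹ (subst (_≤ suc (ℓ (s i · u₀))) (sym len-pkq) (ℓ-w≤′ u₀ i)))
              (subst₂ _≤_ (cong ℓ value) (length-reverse (p ++ q)) (ℓ-word (reverse (p ++ q)))))

  parabolic-descent : ∀ J h → InParabolic J h → 0 < ℓ h → Σ (Fin n) λ k → k ∈ J × N h (s k) ≡ true
  parabolic-descent J _ (b , b∈ , refl) pos with reduced-parabolic-word J b b∈
  ... | [] , _ , _ , ℓc = ⊥-elim (<-irrefl refl (subst (0 <_) (sym ℓc) pos))
  ... | (i ∷ c₀) , c∈ , ec , ℓc with last-letter i c₀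
  ... | p , k , eqc = k , k∈ , descent⇒inversion (eval b) (s k) (s-reflection k) shorter
    where
      k∈ : k ∈ J
      k∈ with ++⁻ʳ p (subst (All (λ i → i ∈ J)) eqc c∈)
      ... | k∈′ ∷ [] = k∈′
      b·sₖ : eval b · s k ≡ eval p
      b·sₖ = trans (cong (_· s k) (trans (sym ec) (trans (cong eval eqc) (eval-snoc p k)))) (s-cancelʳ (eval p) k)
      shorter : ℓ (eval b · s k) < ℓ (eval b)
      shorter = subst (_< ℓ (eval b)) (cong ℓ (sym b·sₖ)) (≤-<-trans (ℓ-word p)
                  (subst (length p <_) (trans (trans (+-comm 1 (length p)) (sym (length-++ p {[ k ]}))) (trans (cong length (sym eqc)) ℓc)) (n<1+n _)))

  parabolic-left-descent : ∀ J h → InParabolic J h → 0 < ℓ h → Σ (Fin n) λ k → k ∈ J × ℓ (s k · h) < ℓ h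
  parabolic-left-descent J h h∈ pos with parabolic-descent J (h ⁻¹) (parabolic-inv J h h∈) (subst (0 <_) (sym (ℓ-inv h)) pos)
  ... | k , k∈ , Nk = k , k∈ , subst₂ _<_ (sym (ℓ-sw≡ℓ-inv-s h k)) (ℓ-inv h) (inversion⇒descent (h ⁻¹) (s k) Nk)

  descent-pair-contradiction : ∀ g h k → ℓ (g · s k) < ℓ g → ℓ (s k · h) < ℓ h → ℓ g + ℓ h ≡ ℓ (g · h) → ⊥
  descent-pair-contradiction g h k gs sh additive =
    <-irrefl refl (≤-<-trans bound (subst (ℓ (g · s k) + ℓ (s k · h) <_) additive (+-mono-< gs sh)))
    where
      bound : ℓ (g · h) ≤ ℓ (g · s k) + ℓ (s k · h)
      bound = subst (λ z → ℓ z ≤ ℓ (g · s k) + ℓ (s k · h)) (trans (assoc _ _ _) (cong (g ·_) (s-cancelˡ h k))) (ℓ-mul _ _)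

  descents-block-growth : ∀ J g w → (∀ k → k ∈ J → ℓ (g · s k) < ℓ g) → InParabolic J ((g ⁻¹) · w) → g ≤w w → g ≡ w
  descents-block-growth J g w desc h∈ g≤w with ℓ ((g ⁻¹) · w) in eq
  ... | zero = trans (sym (identityʳ g)) (trans (cong (g ·_) (sym (ℓ≡0⇒e _ eq))) (inv-cancelˡ′ g w))
  ... | suc _ with parabolic-left-descent J ((g ⁻¹) · w) h∈ (subst (0 <_) (sym eq) (s≤s z≤n))
  ... | k , k∈ , left = ⊥-elim (descent-pair-contradiction g ((g ⁻¹) · w) k (desc k k∈) left
                           (trans (trans (cong (ℓ g +_) eq) g≤w) (cong ℓ (sym (inv-cancelˡ′ g w)))))

  has-descent-in? : ∀ J z → Dec (Σ (Fin n) λ k → k ∈ J × N z (s k) ≡ true)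
  has-descent-in? J z = any? (λ k → (k ∈? J) ×-dec (N z (s k) ≟𝔹 true))

  -- Every z factors as z₂ r with z₂ ∈ W^J, r ∈ W_J and ℓ(z₂) ≤ ℓ(z)
  -- (strip right descents in J one at a time; k bounds the length).
  coset-factorisation : ∀ J k z → ℓ z ≤ k → Σ W λ z₂ → Σ W λ r →
                        MinimalRep J z₂ × InParabolic J r × (z ≡ z₂ · r) × ℓ z₂ ≤ ℓ z
  coset-factorisation J k z ℓz≤k with has-descent-in? J z
  ... | no none = z , e , minimal , parabolic-e J , sym (identityʳ z) , ≤-refl
    where
      minimal : MinimalRep J z
      minimal i i∈ with N z (s i) in eq
      ... | true = ⊥-elim (none (i , i∈ , eq))
      ... | false = non-inversion⇒ascent z (s i) (s-reflection i) eq
  ... | yes (j , j∈ , Nj) with k | ≤-trans (inversion⇒descent z (s j) Nj) ℓz≤k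
  ... | suc k′ | s≤s shorter with coset-factorisation J k′ (z · s j) shorter
  ... | z₂ , r , z₂-min , r∈ , eq , ℓz₂ = z₂ , r · s j , z₂-min , parabolic-mul J r (s j) r∈ (parabolic-s J j j∈) ,
          trans (sym (s-cancelʳ z j)) (trans (cong (_· s j) eq) (assoc _ _ _)) ,
          ≤-trans ℓz₂ (<⇒≤ (inversion⇒descent z (s j) Nj))

  no-shortening⇒no-inversion : ∀ J z → (∀ g → InParabolic J g → ℓ z ≤ ℓ (z · g)) → ∀ r → InParabolic J r → N z r ≡ false
  no-shortening⇒no-inversion J z long r r∈ with N z r in eq
  ... | true = ⊥-elim (<-irrefl refl (<-≤-trans (inversion⇒descent z r eq) (long r r∈)))
  ... | false = refl

  clean-prefix : ∀ J z g → (∀ r → InParabolic J r → N z r ≡ false) → InParabolic J g →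
                 ∀ r → InParabolic J r → N (z · g) r ≡ N g r
  clean-prefix J z g z-clean g∈ r r∈ =
    trans (cocycle z g r) (trans (cong (N g r xor_) (z-clean _ (parabolic-conj J g r g∈ r∈))) (xor-identityʳ _))

  descent-of-product : ∀ J z h → (∀ r → InParabolic J r → N z r ≡ false) → InParabolic J h → 0 < ℓ h →
                       Σ (Fin n) λ k → k ∈ J × N (z · h) (s k) ≡ true
  descent-of-product J z h z-clean h∈ pos with parabolic-descent J h h∈ pos
  ... | k , k∈ , Nk = k , k∈ , trans (clean-prefix J z h z-clean h∈ (s k) (parabolic-s J k k∈)) Nk

  minRep-length : ∀ J k x → ℓ x ≤ k → MinimalRep J x → ∀ g → InParabolic J g → ℓ x ≤ ℓ (x · g)
  minRep-length J zero x ℓx≤0 _ g _ = ≤-trans ℓx≤0 z≤n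
  minRep-length J (suc k) x ℓx≤k x-min g g∈ with ℓ x ≤? ℓ (x · g)
  ... | yes ok = ok
  ... | no longer with coset-factorisation J (ℓ (x · g)) (x · g) ≤-refl
  ... | z , r , z-min , r∈ , xg≡zr , ℓz≤ = ⊥-elim (contradiction (descent-of-product J z h z-clean h∈ h-nontrivial))
    where
      h = r · (g ⁻¹)
      h∈ : InParabolic J h
      h∈ = parabolic-mul J r (g ⁻¹) r∈ (parabolic-inv J g g∈)
      x≡zh : x ≡ z · h
      x≡zh = sym (trans (sym (assoc _ _ _)) (trans (cong (_· (g ⁻¹)) (sym xg≡zr)) (inv-cancelʳ x g)))
      ℓz<ℓx : ℓ z < ℓ x
      ℓz<ℓx = ≤-<-trans ℓz≤ (≰⇒> longer)
      z-clean : ∀ r → InParabolic J r → N z r ≡ false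
      z-clean = no-shortening⇒no-inversion J z (minRep-length J k z (s≤s⁻¹ (≤-trans ℓz<ℓx ℓx≤k)) z-min)
      h-nontrivial : 0 < ℓ h
      h-nontrivial with ℓ h in eqh
      ... | zero = ⊥-elim (<-irrefl (cong ℓ (sym (trans x≡zh (trans (cong (z ·_) (ℓ≡0⇒e h eqh)) (identityʳ z))))) ℓz<ℓx)
      ... | suc _ = s≤s z≤n
      contradiction : (Σ (Fin n) λ j → j ∈ J × N (z · h) (s j) ≡ true) → ⊥
      contradiction (j , j∈ , Nj) = ≤⇒≯ (<⇒≤ (x-min j j∈))
        (subst (λ w → ℓ (w · s j) < ℓ w) (sym x≡zh) (inversion⇒descent (z · h) (s j) Nj))

  minRep-non-inversion : ∀ J x → MinimalRep J x → ∀ r → InParabolic J r → N x r ≡ false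
  minRep-non-inversion J x x-min = no-shortening⇒no-inversion J x (minRep-length J (ℓ x) x ≤-refl x-min)

  -- x ≤ x g for x ∈ W^J and g ∈ W_J: the left inversions of x g are those of x
  -- together with x r x⁻¹ for the left inversions r of g.
  minRep-≤w : ∀ J x → MinimalRep J x → ∀ g → InParabolic J g → x ≤w (x · g)
  minRep-≤w J x x-min g g∈ = inversions-anti x (x · g) λ t h →
      let Nxr = trans (sym (N-inv′ x t)) h
      in trans (N-product′ x g t) (cong₂ _xor_ Nxr (g-clean (conj (x ⁻¹) t) Nxr))
    where
      g-clean : ∀ r → N x r ≡ true → N (g ⁻¹) r ≡ false
      g-clean r Nxr with N (g ⁻¹) r in eq
      ... | false = refl
      ... | true with trans (sym Nxr) (minRep-non-inversion J x x-min r
                        (inversion-in-parabolic J (g ⁻¹) r (parabolic-inv J g g∈) eq))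
      ... | ()

  minRep-length-additive : ∀ J x → MinimalRep J x → ∀ g → InParabolic J g → ℓ (x · g) ≡ ℓ x + ℓ g
  minRep-length-additive J x x-min g g∈ = sym (subst (λ z → ℓ x + ℓ z ≡ ℓ (x · g)) (inv-cancelˡ x g) (minRep-≤w J x x-min g g∈))

  minRep-translate-≤w : ∀ J x → MinimalRep J x → ∀ a b → InParabolic J a → InParabolic J b → a ≤w b → (x · a) ≤w (x · b)
  minRep-translate-≤w J x x-min a b a∈ b∈ a≤b = begin
    ℓ (x · a) + ℓ (((x · a) ⁻¹) · (x · b)) ≡⟨ cong₂ _+_ (minRep-length-additive J x x-min a a∈) (cong ℓ cancel-x) ⟩
    (ℓ x + ℓ a) + ℓ ((a ⁻¹) · b)            ≡⟨ +-assoc (ℓ x) (ℓ a) _ ⟩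
    ℓ x + (ℓ a + ℓ ((a ⁻¹) · b))            ≡⟨ cong (ℓ x +_) a≤b ⟩
    ℓ x + ℓ b                               ≡⟨ sym (minRep-length-additive J x x-min b b∈) ⟩
    ℓ (x · b)                               ∎
    where
      cancel-x : ((x · a) ⁻¹) · (x · b) ≡ (a ⁻¹) · b
      cancel-x = trans (cong (_· (x · b)) (inv-mul x a)) (trans (assoc _ _ _) (cong ((a ⁻¹) ·_) (inv-cancelˡ x b)))

  minRep-above : ∀ J x t → MinimalRep J t → InParabolic J ((t ⁻¹) · x) → x ≤w t → t ≡ x
  minRep-above J x t t-min x∈ x≤t = trans (sym (inv-cancelˡ′ x t)) (trans (cong (x ·_) (ℓ≡0⇒e _ ℓ≡0)) (identityʳ x))
    where
      ℓt≤ℓx : ℓ t ≤ ℓ x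
      ℓt≤ℓx = subst (ℓ t ≤_) (cong ℓ (inv-cancelˡ′ t x)) (minRep-length J (ℓ t) t ≤-refl t-min _ x∈)
      ℓ≡0 : ℓ ((x ⁻¹) · t) ≡ 0
      ℓ≡0 = n≤0⇒n≡0 (+-cancelˡ-≤ (ℓ x) _ _ (subst (_≤ ℓ x + 0) (sym x≤t) (subst (ℓ t ≤_) (sym (+-identityʳ _)) ℓt≤ℓx)))

  longest-inv : ∀ J w₀ → IsLongest J w₀ → IsLongest J (w₀ ⁻¹)
  longest-inv J w₀ (w₀∈ , longest) = parabolic-inv J w₀ w₀∈ , λ u u∈ → subst (ℓ u ≤_) (sym (ℓ-inv w₀)) (longest u u∈)

  longest-inverts : ∀ J w₀ → IsLongest J w₀ → ∀ t → Reflection t → InParabolic J t → N w₀ t ≡ true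
  longest-inverts J w₀ (w₀∈ , longest) t t-refl t∈ with N w₀ t in eq
  ... | true = refl
  ... | false = ⊥-elim (<-irrefl refl (<-≤-trans (non-inversion⇒ascent w₀ t t-refl eq) (longest (w₀ · t) (parabolic-mul J w₀ t w₀∈ t∈))))

  longest-max : ∀ J w₀ → IsLongest J w₀ → ∀ u → InParabolic J u → u ≤w w₀
  longest-max J w₀ lw u u∈ = inversions-anti u w₀ λ t h →
    longest-inverts J (w₀ ⁻¹) (longest-inv J w₀ lw) t (inversion⇒reflection (u ⁻¹) t h)
      (inversion-in-parabolic J (u ⁻¹) t (parabolic-inv J u u∈) h)

  all-descents⇒longest : ∀ J w₀ → IsLongest J w₀ → ∀ g → InParabolic J g → (∀ k → k ∈ J → N g (s k) ≡ true) → g ≡ w₀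
  all-descents⇒longest J w₀ lw g g∈ desc =
    descents-block-growth J g w₀ (λ k k∈ → inversion⇒descent g (s k) (desc k k∈))
      (parabolic-mul J (g ⁻¹) w₀ (parabolic-inv J g g∈) (proj₁ lw)) (longest-max J w₀ lw g g∈)

  -- If every sₖ (k ∈ J) is a right descent of y, then y inverts every reflection of W_J:
  -- write y = y₂ g with y₂ ∈ W^J; then g ∈ W_J has all these descents, so g = w_{∘,J}.
  all-descents⇒inverts : ∀ J w₀ → IsLongest J w₀ → ∀ y → (∀ k → k ∈ J → N y (s k) ≡ true) →
                         ∀ r → Reflection r → InParabolic J r → N y r ≡ true
  all-descents⇒inverts J w₀ lw y desc r r-refl r∈ with coset-factorisation J (ℓ y) y ≤-refl
  ... | y₂ , g , y₂-min , g∈ , refl , _ =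
    trans (same r r∈) (subst (λ w → N w r ≡ true) (sym g≡w₀) (longest-inverts J w₀ lw r r-refl r∈))
    where
      same : ∀ r → InParabolic J r → N (y₂ · g) r ≡ N g r
      same = clean-prefix J y₂ g (minRep-non-inversion J y₂ y₂-min) g∈
      g≡w₀ : g ≡ w₀
      g≡w₀ = all-descents⇒longest J w₀ lw g g∈ (λ k k∈ → trans (sym (same (s k) (parabolic-s J k k∈))) (desc k k∈))

  -- Whether a generator lies in W_I is decidable: a reduced I-word for sⱼ has a single letter.
  generator-in-parabolic? : ∀ I j → InParabolic I (s j) ⊎ (¬ InParabolic I (s j))
  generator-in-parabolic? I j with any? (λ i → (i ∈? I) ×-dec (s i ≟W s j))
  ... | yes (i , i∈ , eq) = inj₁ (subst (InParabolic I) eq (parabolic-s I i i∈))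
  ... | no none = inj₂ not-in
    where
      not-in : InParabolic I (s j) → ⊥
      not-in (b , b∈ , eb) with reduced-parabolic-word I b b∈
      ... | [] , _ , _ , ℓc = ⊥-elim (0≢1+n (trans ℓc (trans (cong ℓ eb) (ℓ-s j))))
      ... | (i ∷ []) , (i∈ ∷ []) , ec , _ = none (i , i∈ , trans (sym (identityʳ (s i))) (trans ec eb))
      ... | (i ∷ k ∷ c) , _ , _ , ℓc = ⊥-elim (1+n≢0 (suc-injective (trans ℓc (trans (cong ℓ eb) (ℓ-s j)))))

module CosetProjections (C : CoxeterSystem) where
  open CoxeterSystem C
  open Coxeter C
  open GroupBasics C
  open ReflectionCocycle C
  open Inversions C
  open WeakOrder C
  open Parabolic C
  open ≡-Reasoning

  same-coset : ∀ x g I K → InParabolic I g → (∀ i → i ∈ I → InParabolic K (s i)) → (∀ j → j ∈ K → InParabolic I (s j)) →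
               SameCoset (x · g) K x I
  same-coset x g I K g∈ I⊆K K⊆I w =
      (λ w∈xgW_K → subst (InParabolic I) (inv-cancelˡ′ g ((x ⁻¹) · w))
                     (parabolic-mul I g _ g∈ (subst (InParabolic I) shift (parabolic-mono K I K⊆I _ w∈xgW_K)))) ,
      (λ w∈xW_I → parabolic-mono I K I⊆K _ (subst (InParabolic I) (sym shift) (parabolic-mul I (g ⁻¹) _ (parabolic-inv I g g∈) w∈xW_I)))
    where
      shift : ((x · g) ⁻¹) · w ≡ (g ⁻¹) · ((x ⁻¹) · w)
      shift = trans (cong (_· w) (inv-mul x g)) (assoc _ _ _)

  -- Part (i), W_I ⊆ W_K: for i ∈ I the reflection x sᵢ x⁻¹ is a left inversion of
  -- x w₀I, hence of x w₀K; as it is not one of x, sᵢ is inverted by w₀K⁻¹.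
  I⊆Σ↑ : ∀ x I K w₀I w₀K → MinimalRep I x → IsLongest I w₀I → IsLongest K w₀K →
         (x · w₀I) ≤w (x · w₀K) → ∀ i → i ∈ I → InParabolic K (s i)
  I⊆Σ↑ x I K w₀I w₀K x-min lI lK le i i∈ =
    inversion-in-parabolic K (w₀K ⁻¹) (s i) (proj₁ (longest-inv K w₀K lK)) w₀K⁻¹-inverts
    where
      x-clean : N x (s i) ≡ false
      x-clean = ascent⇒non-inversion x (s i) (x-min i i∈)
      xw₀I-inverts : N ((x · w₀I) ⁻¹) (conj x (s i)) ≡ true
      xw₀I-inverts = trans (N-product x w₀I (s i)) (cong₂ _xor_ x-clean
                       (longest-inverts I (w₀I ⁻¹) (longest-inv I w₀I lI) (s i) (s-reflection i) (parabolic-s I i i∈)))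
      w₀K⁻¹-inverts : N (w₀K ⁻¹) (s i) ≡ true
      w₀K⁻¹-inverts = trans (cong (_xor N (w₀K ⁻¹) (s i)) (sym x-clean))
                        (trans (sym (N-product x w₀K (s i))) (inversions-mono _ _ le _ xw₀I-inverts))

  -- Part (i), the meet x w₀I ∧ x sⱼ is x when sⱼ ∉ W_I: a common lower bound u has
  -- only left inversions t of x, since otherwise x⁻¹ t x would be sⱼ and lie in W_I.
  meet-with-generator : ∀ x I K w₀I j → MinimalRep I x → IsLongest I w₀I → MinimalRep K x → j ∈ K →
                        ¬ InParabolic I (s j) → IsMeet (x · w₀I) (x · s j) x
  meet-with-generator x I K w₀I j x-min lI x-minK j∈ sⱼ∉ =
    minRep-≤w I x x-min w₀I (proj₁ lI) , minRep-≤w K x x-minK (s j) (parabolic-s K j j∈) ,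
    λ u u≤xw₀I u≤xsⱼ → inversions-anti u x (λ t h → trans (N-inv′ x t) (inversion-of-x u u≤xw₀I u≤xsⱼ t h))
    where
      inversion-of-x : ∀ u → u ≤w (x · w₀I) → u ≤w (x · s j) → ∀ t → N (u ⁻¹) t ≡ true → N x (conj (x ⁻¹) t) ≡ true
      inversion-of-x u u≤xw₀I u≤xsⱼ t h with N x (conj (x ⁻¹) t) in eq
      ... | true = refl
      ... | false = ⊥-elim (sⱼ∉ (subst (InParabolic I) r≡sⱼ r∈W_I))
        where
          r = conj (x ⁻¹) t
          via-w₀I : N (w₀I ⁻¹) r ≡ true
          via-w₀I = trans (cong (_xor N (w₀I ⁻¹) r) (sym eq)) (trans (sym (N-product′ x w₀I t)) (inversions-mono u _ u≤xw₀I t h))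
          r∈W_I : InParabolic I r
          r∈W_I = inversion-in-parabolic I (w₀I ⁻¹) r (proj₁ (longest-inv I w₀I lI)) via-w₀I
          r≡sⱼ : r ≡ s j
          r≡sⱼ = δ-true (trans (sym (cong (_xor δ r (s j)) eq)) (trans (cong (N x r xor_) (sym (N-s-inv j r)))
                   (trans (sym (N-product′ x (s j) t)) (inversions-mono u _ u≤xsⱼ t h))))

  -- Part (i), W_K ⊆ W_I: if sⱼ ∉ W_I, the congruence applied to the meets
  -- x w₀I ∧ x sⱼ = x and x w₀K ∧ x sⱼ = x sⱼ gives x ≡ x sⱼ, but x sⱼ is
  -- strictly above x = π↑(x).
  Σ↑⊆I : ∀ R → LatticeCongruence R → ∀ x I K w₀I w₀K → MinimalRep I x → IsLongest I w₀I →
         (∀ u → R x u → u ≤w x) → (∀ i → i ∈ K → ¬ RightDescent x i) → IsLongest K w₀K →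
         R (x · w₀I) (x · w₀K) → ∀ j → j ∈ K → InParabolic I (s j)
  Σ↑⊆I R cong x I K w₀I w₀K x-min lI top asc lK rel j j∈ with generator-in-parabolic? I j
  ... | inj₁ sⱼ∈ = sⱼ∈
  ... | inj₂ sⱼ∉ = ⊥-elim (<-irrefl refl (<-≤-trans (x-minK j j∈) (≤w-length _ _ (top (x · s j) x≡xsⱼ))))
    where
      x-minK : MinimalRep K x
      x-minK = no-descent⇒minRep K x asc
      xsⱼ≤xw₀K : (x · s j) ≤w (x · w₀K)
      xsⱼ≤xw₀K = minRep-translate-≤w K x x-minK (s j) w₀K (parabolic-s K j j∈) (proj₁ lK)
                   (longest-max K w₀K lK (s j) (parabolic-s K j j∈))
      x≡xsⱼ : R x (x · s j)
      x≡xsⱼ = LatticeCongruence.meet-compat cong (x · w₀I) (x · w₀K) (x · s j) x (x · s j) rel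
                (meet-with-generator x I K w₀I j x-min lI x-minK j∈ sⱼ∉) (meet-of-comparable _ _ xsⱼ≤xw₀K)

  -- Part (ii), W_I ⊆ W_K: for i ∈ I, the reflection x r x⁻¹ with r = w₀I sᵢ w₀I⁻¹ is not
  -- a left inversion of x; if w₀K⁻¹ did not invert sᵢ, it would be a left inversion
  -- of x w₀I w₀K ≤ x.
  I⊆Σ↓ : ∀ x I K w₀I w₀K → MinimalRep I x → IsLongest I w₀I → IsLongest K w₀K →
         ((x · w₀I) · w₀K) ≤w x → ∀ i → i ∈ I → InParabolic K (s i)
  I⊆Σ↓ x I K w₀I w₀K x-min lI lK le i i∈ with N (w₀K ⁻¹) (s i) in eqK
  ... | true = inversion-in-parabolic K (w₀K ⁻¹) (s i) (proj₁ (longest-inv K w₀K lK)) eqK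
  ... | false = ⊥-elim (true≢false (trans (sym (inversions-mono z x le (conj x r) z-inverts)) (trans (N-inv x r) x-clean)))
    where
      z = (x · w₀I) · w₀K
      r = conj w₀I (s i)
      x-clean : N x r ≡ false
      x-clean = minRep-non-inversion I x x-min r (parabolic-conj I w₀I (s i) (proj₁ lI) (parabolic-s I i i∈))
      z-inverts : N (z ⁻¹) (conj x r) ≡ true
      z-inverts = begin
        N (z ⁻¹) (conj x r)                              ≡⟨ cong (λ q → N (q ⁻¹) (conj x r)) (assoc x w₀I w₀K) ⟩
        N ((x · (w₀I · w₀K)) ⁻¹) (conj x r)              ≡⟨ N-product x (w₀I · w₀K) r ⟩
        N x r xor N ((w₀I · w₀K) ⁻¹) r                   ≡⟨ cong₂ _xor_ x-clean (N-product w₀I w₀K (s i)) ⟩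
        false xor (N w₀I (s i) xor N (w₀K ⁻¹) (s i))     ≡⟨ cong₂ (λ p q → false xor (p xor q))
                                                              (longest-inverts I w₀I lI (s i) (s-reflection i) (parabolic-s I i i∈)) eqK ⟩
        true                                             ∎

  -- Part (ii), y w₀K ≤ y sⱼ when every sₖ (k ∈ K) is a right descent of y and j ∈ K:
  -- a left inversion of y w₀K is either y sⱼ y⁻¹ or comes from y.
  below-descent : ∀ y K w₀K j → IsLongest K w₀K → (∀ k → k ∈ K → N y (s k) ≡ true) → j ∈ K → (y · w₀K) ≤w (y · s j)
  below-descent y K w₀K j lK desc j∈ = inversions-anti _ _ λ t h →
      trans (N-product′ y (s j) t) (trans (cong (N y (r t) xor_) (N-s-inv j (r t))) (new-or-old t (trans (sym (N-product′ y w₀K t)) h)))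
    where
      r : W → W
      r t = conj (y ⁻¹) t
      lKi = longest-inv K w₀K lK
      new-or-old : ∀ t → N y (r t) xor N (w₀K ⁻¹) (r t) ≡ true → N y (r t) xor δ (r t) (s j) ≡ true
      new-or-old t h with δ (r t) (s j) in eδ
      ... | true = trans (cong (N y (r t) xor_) (sym (subst (λ q → N (w₀K ⁻¹) q ≡ true) (sym (δ-true eδ))
                     (longest-inverts K (w₀K ⁻¹) lKi (s j) (s-reflection j) (parabolic-s K j j∈))))) h
      ... | false with N y (r t) in eq
      ... | true = refl
      ... | false = ⊥-elim (true≢false (trans (sym (all-descents⇒inverts K w₀K lK y desc (r t)
                      (inversion⇒reflection _ (r t) h) (inversion-in-parabolic K (w₀K ⁻¹) (r t) (proj₁ lKi) h))) eq))

  -- Part (ii), the join x ∨ y sⱼ is y = x w₀I when sⱼ ∉ W_I: a left inversion t of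
  -- y is one of x or of y sⱼ, since otherwise y⁻¹ t y = sⱼ would lie in W_I.
  join-with-generator : ∀ x I K w₀I j → MinimalRep I x → IsLongest I w₀I → (∀ i → i ∈ K → RightDescent (x · w₀I) i) →
                        j ∈ K → ¬ InParabolic I (s j) → IsJoin x ((x · w₀I) · s j) (x · w₀I)
  join-with-generator x I K w₀I j x-min lI desc j∈ sⱼ∉ =
    minRep-≤w I x x-min w₀I (proj₁ lI) , descent-≤w y j (desc j j∈) ,
    λ u x≤u ysⱼ≤u → inversions-anti y u (from-x-or-ysⱼ u x≤u ysⱼ≤u)
    where
      y = x · w₀I
      from-x-or-ysⱼ : ∀ u → x ≤w u → (y · s j) ≤w u → ∀ t → N (y ⁻¹) t ≡ true → N (u ⁻¹) t ≡ true
      from-x-or-ysⱼ u x≤u ysⱼ≤u t h with N x (conj (x ⁻¹) t) in eq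
      ... | true = inversions-mono x u x≤u t (trans (N-inv′ x t) eq)
      ... | false with δ (conj (y ⁻¹) t) (s j) in eδ
      ... | false = inversions-mono (y · s j) u ysⱼ≤u t
                      (trans (N-product′ y (s j) t) (trans (cong (N y (conj (y ⁻¹) t) xor_) (N-s-inv j _))
                        (cong₂ _xor_ (trans (sym (N-inv′ y t)) h) eδ)))
      ... | true = ⊥-elim (sⱼ∉ (subst (InParabolic I) (trans (sym conj-y) (δ-true eδ))
                     (parabolic-conj I (w₀I ⁻¹) r (proj₁ (longest-inv I w₀I lI)) r∈W_I)))
        where
          r = conj (x ⁻¹) t
          r∈W_I : InParabolic I r
          r∈W_I = inversion-in-parabolic I (w₀I ⁻¹) r (proj₁ (longest-inv I w₀I lI))
                    (trans (cong (_xor N (w₀I ⁻¹) r) (sym eq)) (trans (sym (N-product′ x w₀I t)) h))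
          conj-y : conj (y ⁻¹) t ≡ conj (w₀I ⁻¹) r
          conj-y = trans (cong (λ q → conj q t) (inv-mul x w₀I)) (sym (conj-comp (w₀I ⁻¹) (x ⁻¹) t))

  -- Part (ii), W_K ⊆ W_I: if sⱼ ∉ W_I, the congruence applied to the joins
  -- y w₀K ∨ y sⱼ = y sⱼ and x ∨ y sⱼ = y gives y sⱼ ≡ y, but y sⱼ is strictly
  -- below y = π↓(y).
  Σ↓⊆I : ∀ R → LatticeCongruence R → ∀ x I K w₀I w₀K → MinimalRep I x → IsLongest I w₀I →
         (∀ u → R (x · w₀I) u → (x · w₀I) ≤w u) → (∀ i → i ∈ K → RightDescent (x · w₀I) i) → IsLongest K w₀K →
         R ((x · w₀I) · w₀K) x → ∀ j → j ∈ K → InParabolic I (s j)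
  Σ↓⊆I R cong x I K w₀I w₀K x-min lI bottom desc lK rel j j∈ with generator-in-parabolic? I j
  ... | inj₁ sⱼ∈ = sⱼ∈
  ... | inj₂ sⱼ∉ = ⊥-elim (<-irrefl refl (<-≤-trans (desc j j∈) (≤w-length _ _ (bottom (y · s j) y≡ysⱼ))))
    where
      y = x · w₀I
      y-inverts : ∀ k → k ∈ K → N y (s k) ≡ true
      y-inverts k k∈ = descent⇒inversion y (s k) (s-reflection k) (desc k k∈)
      ysⱼ≡y : R (y · s j) y
      ysⱼ≡y = LatticeCongruence.join-compat cong (y · w₀K) x (y · s j) (y · s j) y rel
                (join-of-comparable _ _ (below-descent y K w₀K j lK y-inverts j∈))
                (join-with-generator x I K w₀I j x-min lI desc j∈ sⱼ∉)
      y≡ysⱼ : R y (y · s j)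
      y≡ysⱼ = LatticeCongruence.sym′ cong _ _ ysⱼ≡y

  Π↑-fixed : ∀ R → LatticeCongruence R → ∀ x I → MinimalRep I x → ∀ w₀I → IsLongest I w₀I →
             ∀ t → IsTopOf R x t → ∀ K → (∀ i → i ∈ K → ¬ RightDescent t i) → ∀ w₀K → IsLongest K w₀K →
             (x · w₀I) ≤w (t · w₀K) → R (x · w₀I) (t · w₀K) →
             (SameCoset t K x I → t ≡ x) × (t ≡ x → SameCoset t K x I)
  Π↑-fixed R cong x I x-min w₀I lI t (_ , top) K asc w₀K lK le rel = only-if , if
    where
      only-if : SameCoset t K x I → t ≡ x
      only-if same = minRep-above K x t (no-descent⇒minRep K t asc)
                       (proj₂ (same x) (subst (InParabolic I) (sym (inverseˡ x)) (parabolic-e I)))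
                       (top x (LatticeCongruence.refl′ cong x))
      if : t ≡ x → SameCoset t K x I
      if refl = subst (λ z → SameCoset z K x I) (identityʳ x)
        (same-coset x e I K (parabolic-e I) (I⊆Σ↑ x I K w₀I w₀K x-min lI lK le)
          (Σ↑⊆I R cong x I K w₀I w₀K x-min lI top asc lK rel))

  Π↓-fixed : ∀ R → LatticeCongruence R → ∀ x I → MinimalRep I x → ∀ w₀I → IsLongest I w₀I →
             ∀ b → IsBottomOf R (x · w₀I) b → ∀ K → (∀ i → i ∈ K → RightDescent b i) → ∀ w₀K → IsLongest K w₀K →
             (b · w₀K) ≤w x → R (b · w₀K) x →
             (SameCoset b K x I → b ≡ x · w₀I) × (b ≡ x · w₀I → SameCoset b K x I)
  Π↓-fixed R cong x I x-min w₀I lI b (_ , bottom) K desc w₀K lK le rel = only-if , if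
    where
      only-if : SameCoset b K x I → b ≡ x · w₀I
      only-if same = descents-block-growth K b (x · w₀I) desc
                       (proj₂ (same (x · w₀I)) (subst (InParabolic I) (sym (inv-cancelˡ x w₀I)) (proj₁ lI)))
                       (bottom (x · w₀I) (LatticeCongruence.refl′ cong (x · w₀I)))
      if : b ≡ x · w₀I → SameCoset b K x I
      if refl = same-coset x w₀I I K (proj₁ lI) (I⊆Σ↓ x I K w₀I w₀K x-min lI lK le)
                  (Σ↓⊆I R cong x I K w₀I w₀K x-min lI bottom desc lK rel)

proposition4p15 : (C : CoxeterSystem) →
  let open CoxeterSystem C
      open Coxeter C
  in (R : W → W → Set) → LatticeCongruence R →
     (x : W) (I : Subset n) → MinimalRep I x →
     (w₀I : W) → IsLongest I w₀I →
     -- (i): t = π↑(x), Σ = Σ↑(x,I), w₀Σ = w_{∘,Σ}; Π↑(xW_I) = t W_Σ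
     ((t : W) → IsTopOf R x t →
      (Σ↑ : Subset n) → (∀ i → i ∈ Σ↑ → ¬ RightDescent t i) →
      (w₀Σ : W) → IsLongest Σ↑ w₀Σ →
      (x · w₀I) ≤w (t · w₀Σ) → R (x · w₀I) (t · w₀Σ) →
      (SameCoset t Σ↑ x I → t ≡ x) × (t ≡ x → SameCoset t Σ↑ x I))
     ×
     -- (ii): b = π↓(x w_{∘,I}), Σ = Σ↓(x,I); Π↓(xW_I) = b W_Σ
     ((b : W) → IsBottomOf R (x · w₀I) b →
      (Σ↓ : Subset n) → (∀ i → i ∈ Σ↓ → RightDescent b i) →
      (w₀Σ : W) → IsLongest Σ↓ w₀Σ →
      (b · w₀Σ) ≤w x → R (b · w₀Σ) x →
      (SameCoset b Σ↓ x I → b ≡ x · w₀I) × (b ≡ x · w₀I → SameCoset b Σ↓ x I))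
proposition4p15 C R cong x I x-min w₀I lI =
  Π↑-fixed R cong x I x-min w₀I lI , Π↓-fixed R cong x I x-min w₀I lI
  where open CosetProjections C
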